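{- Let $T$ be a plane tree with $n$ regions and root $\rho$. Then $$\mathbf M_T(\mathbb X)=\frac{1-t^{a(\rho)-1}}{1-q^n}\prod_{i\in\mathrm{Int}(T)}\frac{q^{r(i)}-t^{a(i)-1}}{1-q^{r(i)}},$$ where $\mathrm{Int}(T)$ is the set of internal nodes of $T$ other than the root, $a(i)$ is the arity (number of children) of the node $i$, and $r(i)$ is the number of regions of $T$ in the subtree rooted at $i$.
   Context: Plane trees: rooted ordered trees whose internal nodes have arity at least $2$; leaves are not counted as nodes. A region of $T$ is a part of the plane between two consecutive edges going down from the same internal node, so a node of arity $a$ has $a-1$ regions. For a (possibly empty) word $w$ over positive integers, its decreasing plane tree $\mathcal T(w)$ is a leaf if $w$ is empty; otherwise, if $m$ is the maximal letter of $w$, occurring $k$ times, write $w=w_0mw_1m\cdots mw_k$ with no $w_j$ containing $m$; then $\mathcal T(w)$ has a root of arity $k+1$ whose subtrees, from left to right, are $\mathcal T(w_0),\dots,\mathcal T(w_k)$. A packed word is a word with letter set $\{1,\dots,p\}$. For a packed word $u$ of length $N$ with evaluation $(i_1,\dots,i_p)=(|u|_1,\dots,|u|_p)$ the $(q,t)$-specialization at $\mathbb X=\frac1{1-q}\hat\times(1-t)$ of the $\mathbf{WQSym}$ basis element $\mathbf M_u$ is $\mathbf M_u(\mathbb X)=\frac{1-t^{i_p}}{1-q^N}\prod_{k=1}^{p-1}\frac{q^{i_1+\cdots+i_k}-t^{i_k}}{1-q^{i_1+\cdots+i_k}}$. The Loday–Ronco basis element of the free dendriform trialgebra is $\mathbf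 M_T=\sum_{\mathcal T(u)=T}\mathbf M_u$, so $\mathbf M_T(\mathbb X)=\sum_{u\ \mathrm{packed},\ \mathcal T(u)=T}\mathbf M_u(\mathbb X)$. -}

module Defs where

open import Data.Nat as ℕ using (ℕ; zero; suc; _⊔_)
open import Data.List using (List; []; _∷_; map; foldr; length; upTo; filter; concatMap; all)
open import Data.Bool using (Bool; true; false; if_then_else_)
open import Data.Product using (_×_; _,_)
open import Data.Rational using (ℚ; 0ℚ; 1ℚ; _+_; _*_; _-_; 1/_; ≢-nonZero)
open import Data.Rational.Properties using (_≟_)
open import Data.List.Membership.DecPropositional ℕ._≟_ using (_∈_; _∈?_)
open import Data.List.Relation.Unary.All using (All; all?)
open import Relation.Nullary using (Dec; yes; no; ¬_)
open import Relation.Nullary.Decidable using (_×-dec_; map′)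
open import Relation.Binary.PropositionalEquality using (_≡_; refl; cong; cong₂)

-- Plane trees: internal nodes have arity ≥ 2 (two mandatory children
-- followed by a list of further children); leaves are not nodes.

data PTree : Set where
  leaf : PTree
  node : PTree → PTree → List PTree → PTree

children : PTree → PTree → List PTree → List PTree
children l r ts = l ∷ r ∷ ts

node-inj : ∀ {l r ts l' r' ts'} → node l r ts ≡ node l' r' ts' →
           (l ≡ l') × (r ≡ r') × (ts ≡ ts')
node-inj refl = refl , refl , refl

∷-inj : ∀ {x y : PTree} {xs ys} → x ∷ xs ≡ y ∷ ys → (x ≡ y) × (xs ≡ ys)
∷-inj refl = refl , refl

mutual
  _≟ᵀ_ : (T U : PTree) → Dec (T ≡ U)
  leaf ≟ᵀ leaf = yes refl
  leaf ≟ᵀ node _ _ _ = no λ ()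
  node _ _ _ ≟ᵀ leaf = no λ ()
  node l r ts ≟ᵀ node l' r' ts' with l ≟ᵀ l' | r ≟ᵀ r' | ts ≟ᴸ ts'
  ... | yes refl | yes refl | yes refl = yes refl
  ... | no ne | _ | _ = no λ e → let (a , _ , _) = node-inj e in ne a
  ... | yes _ | no ne | _ = no λ e → let (_ , b , _) = node-inj e in ne b
  ... | yes _ | yes _ | no ne = no λ e → let (_ , _ , c) = node-inj e in ne c

  _≟ᴸ_ : (ts us : List PTree) → Dec (ts ≡ us)
  [] ≟ᴸ [] = yes refl
  [] ≟ᴸ (_ ∷ _) = no λ ()
  (_ ∷ _) ≟ᴸ [] = no λ ()
  (t ∷ ts) ≟ᴸ (u ∷ us) with t ≟ᵀ u | ts ≟ᴸ us
  ... | yes refl | yes refl = yes refl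
  ... | no ne | _ = no λ e → ne (Data.Product.proj₁ (∷-inj e))
  ... | yes _ | no ne = no λ e → ne (Data.Product.proj₂ (∷-inj e))

Word : Set
Word = List ℕ

maxL : Word → ℕ
maxL = foldr _⊔_ 0

countL : ℕ → Word → ℕ
countL m [] = 0
countL m (x ∷ w) = if does (x ℕ.≟ m) then suc (countL m w) else countL m w
  where open Relation.Nullary using (does)

splitAt : ℕ → Word → List Word
splitAt m [] = [] ∷ []
splitAt m (x ∷ w) with x ℕ.≟ m | splitAt m w
... | yes _ | ws = [] ∷ ws
... | no _ | [] = (x ∷ []) ∷ []
... | no _ | v ∷ ws = (x ∷ v) ∷ ws

-- build m w computes 𝒯(w) for a word w whose letters are all ≤ m
-- (letters positive): if m occurs in w it is the maximal letter and w is
-- split along its occurrences, otherwise we pass to m - 1.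
build : ℕ → Word → PTree
build zero w = leaf
build (suc m) w with splitAt (suc m) w
... | w₀ ∷ w₁ ∷ ws = node (build m w₀) (build m w₁) (map (build m) ws)
... | _ = build m w

𝒯 : Word → PTree
𝒯 w = build (maxL w) w

mutual
  -- number of regions: a node of arity a has a - 1 regions
  regions : PTree → ℕ
  regions leaf = 0
  regions (node l r ts) = length (r ∷ ts) ℕ.+ (regions l ℕ.+ (regions r ℕ.+ regionsL ts))

  regionsL : List PTree → ℕ
  regionsL [] = 0
  regionsL (t ∷ ts) = regions t ℕ.+ regionsL ts

arity : PTree → PTree → List PTree → ℕ
arity l r ts = length (children l r ts)

_^_ : ℚ → ℕ → ℚ
p ^ zero = 1ℚ
p ^ suc n = p * (p ^ n)

-- total division (x / 0 := 0); only used at nonzero denominators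
infixl 7 _÷₀_
_÷₀_ : ℚ → ℚ → ℚ
p ÷₀ q with q ≟ 0ℚ
... | yes _ = 0ℚ
... | no q≢0 = p * (1/_ q {{≢-nonZero q≢0}})

mutual
  nodeProd : ℚ → ℚ → PTree → ℚ
  nodeProd q t leaf = 1ℚ
  nodeProd q t (node l r ts) =
    ((q ^ regions (node l r ts) - t ^ (arity l r ts ℕ.∸ 1))
       ÷₀ (1ℚ - q ^ regions (node l r ts)))
    * (nodeProd q t l * (nodeProd q t r * nodeProdL q t ts))

  nodeProdL : ℚ → ℚ → List PTree → ℚ
  nodeProdL q t [] = 1ℚ
  nodeProdL q t (T ∷ Ts) = nodeProd q t T * nodeProdL q t Ts

-- RHS for a tree whose root has children l r ts: product over the
-- internal nodes other than the root = product over the subtrees of the root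
rhs : ℚ → ℚ → PTree → PTree → List PTree → ℚ
rhs q t l r ts =
  ((1ℚ - t ^ (arity l r ts ℕ.∸ 1)) ÷₀ (1ℚ - q ^ regions (node l r ts)))
  * nodeProdL q t (children l r ts)

oneTo : ℕ → List ℕ
oneTo p = map suc (upTo p)

wordsOver : ℕ → ℕ → List Word
wordsOver p zero = [] ∷ []
wordsOver p (suc N) = concatMap (λ x → map (x ∷_) (wordsOver p N)) (oneTo p)

partialSum : Word → ℕ → ℕ
partialSum u zero = 0
partialSum u (suc k) = partialSum u k ℕ.+ countL (suc k) u

prodL : List ℚ → ℚ
prodL = foldr _*_ 1ℚ

sumL : List ℚ → ℚ
sumL = foldr _+_ 0ℚ

Mword : ℚ → ℚ → ℕ → Word → ℚ
Mword q t p u =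
  ((1ℚ - t ^ countL p u) ÷₀ (1ℚ - q ^ length u))
  * prodL (map (λ k → (q ^ partialSum u k - t ^ countL k u)
                        ÷₀ (1ℚ - q ^ partialSum u k))
               (oneTo (p ℕ.∸ 1)))

packedWithTree : PTree → ℕ → ℕ → List Word
packedWithTree T N p =
  filter (λ u → all? (_∈? u) (oneTo p) ×-dec (𝒯 u ≟ᵀ T)) (wordsOver p N)

-- 𝐌_T(𝕏) = Σ_{u packed, 𝒯(u) = T} 𝐌_u(𝕏); for T with n regions every such
-- u has length n (one letter per region), hence 1 ≤ p ≤ n.
MT : ℚ → ℚ → PTree → ℚ
MT q t T =
  sumL (concatMap (λ p → map (Mword q t p) (packedWithTree T (regions T) p))
                  (oneTo (regions T)))

module Submission where

-- Group the packed words u with 𝒯(u) = T by their maximal letter P + 1.  This letter occurs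
-- exactly a(ρ) - 1 times, as the separators of the root, so the factor of 𝐌_u(𝕏) belonging
-- to it is the constant (1 - t^{a(ρ)-1})/(1 - q^n), and erasing it cuts u into words over
-- {1, …, P} whose trees are the root subtrees F = (T₀, …, T_k).  Hence 𝐌_T(𝕏) is that
-- constant times Σ_P Z_P(F), where Z_P(F) sums the product of the remaining factors over the
-- tuples of words over {1, …, P} with trees F whose concatenation is packed.
--
-- The same erasure applied to the forest F shows that in a word over {1, …, P + 1} each
-- tree either avoids P + 1 or carries it at its root, so that
--   Z_{P+1}(F) = Σ_{F′, i} c_{|F|}(i) Z_P(F′),
-- where F′ runs over the forests obtained by replacing some trees by their root subtrees,
-- i counts the removed separators, and c_N(i) = (q^N 1^i - t^i)/(1 - q^N) + 0^i.  Being linear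
-- in 1^i, t^i, 0^i, this recursion is solved by the product over the internal nodes, because
-- φ_T(x) = ν(T) + x^{a(T)-1} ν(T₀)⋯ν(T_k) satisfies q^{r(T)} φ_T(1) = φ_T(t) for the node
-- factor ν; induction on the number of regions then evaluates Σ_P Z_P(F).

open import Defs
open import Data.Nat as ℕ using (ℕ; zero; suc; _≤_; _<_; z≤n; s≤s)
import Data.Nat.Properties as ℕₚ
open import Data.Bool using (Bool; true; false; _∧_; if_then_else_)
open import Data.Bool.Properties using (∧-comm; ∧-identityʳ; ∧-zeroʳ)
open import Data.Empty using (⊥-elim)
open import Data.List
  using (List; []; _∷_; [_]; _++_; map; length; upTo; filter; concatMap)
import Data.List.Properties as List
open import Data.List.Relation.Unary.All as All using (All; []; _∷_; all?)
import Data.List.Relation.Unary.All.Properties as All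
open import Data.List.Relation.Unary.Any using (here; there)
open import Data.List.Membership.DecPropositional ℕ._≟_ using (_∈_; _∈?_)
open import Data.Nat.Solver renaming (module +-*-Solver to ℕ-Solver)
open import Data.Product using (_×_; _,_; proj₂)
open import Data.Rational using (ℚ; 0ℚ; 1ℚ; _+_; _*_; _-_; -_; ≢-nonZero)
import Data.Rational.Properties as ℚ
open import Data.Rational.Solver renaming (module +-*-Solver to ℚ-Solver)
open import Function using (_∘_; id)
open import Function.Bundles using (_⇔_; mk⇔)
open import Relation.Nullary using (Dec; yes; no; ¬_; does)
open import Relation.Nullary.Decidable using (_×-dec_; dec-true; dec-false; does-⇔)
open import Relation.Binary.PropositionalEquality hiding ([_])

_⁻¹ : ℚ → ℚ
x ⁻¹ = 1ℚ ÷₀ x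

÷₀≡*⁻¹ : ∀ x y → x ÷₀ y ≡ x * y ⁻¹
÷₀≡*⁻¹ x y with y ℚ.≟ 0ℚ
... | yes _ = sym (ℚ.*-zeroʳ x)
... | no _ = cong (x *_) (sym (ℚ.*-identityˡ _))

*-⁻¹-inverse : ∀ y → y ≢ 0ℚ → y * y ⁻¹ ≡ 1ℚ
*-⁻¹-inverse y y≢0 with y ℚ.≟ 0ℚ
... | yes y≡0 = ⊥-elim (y≢0 y≡0)
... | no y≢0' = trans (cong (y *_) (ℚ.*-identityˡ _)) (ℚ.*-inverseʳ y {{≢-nonZero y≢0'}})

1-x≡0⇒x≡1 : ∀ x → 1ℚ - x ≡ 0ℚ → x ≡ 1ℚ
1-x≡0⇒x≡1 x 1-x≡0 =
  trans (solve 1 (λ x → x := con 1ℚ :- (con 1ℚ :- x)) refl x) (cong (λ y → 1ℚ - y) 1-x≡0)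
  where open ℚ-Solver

^-distribˡ-+-* : ∀ x a b → x ^ (a ℕ.+ b) ≡ x ^ a * x ^ b
^-distribˡ-+-* x zero b = sym (ℚ.*-identityˡ _)
^-distribˡ-+-* x (suc a) b = trans (cong (x *_) (^-distribˡ-+-* x a b)) (sym (ℚ.*-assoc x _ _))

^-zeroˡ : ∀ n → 1ℚ ^ n ≡ 1ℚ
^-zeroˡ zero = refl
^-zeroˡ (suc n) = trans (ℚ.*-identityˡ _) (^-zeroˡ n)

0^suc≡0 : ∀ n → 0ℚ ^ suc n ≡ 0ℚ
0^suc≡0 n = ℚ.*-zeroˡ (0ℚ ^ n)

infixr 8 [_]·_

[_]·_ : Bool → ℚ → ℚ
[ true ]· x = x
[ false ]· x = 0ℚ

[]·-zero : ∀ b → [ b ]· 0ℚ ≡ 0ℚ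
[]·-zero true = refl
[]·-zero false = refl

[]·-*-comm : ∀ b c x → [ b ]· (c * x) ≡ c * [ b ]· x
[]·-*-comm true c x = refl
[]·-*-comm false c x = sym (ℚ.*-zeroʳ c)

[]·-+ : ∀ b x y → [ b ]· (x + y) ≡ [ b ]· x + [ b ]· y
[]·-+ true x y = refl
[]·-+ false x y = refl

[]·-∧ : ∀ a b x → [ a ]· [ b ]· x ≡ [ a ∧ b ]· x
[]·-∧ true b x = refl
[]·-∧ false b x = refl

[yes]· : ∀ {a} {A : Set a} (A? : Dec A) → A → ∀ x → [ does A? ]· x ≡ x
[yes]· A? a x rewrite dec-true A? a = refl

[no]· : ∀ {a} {A : Set a} (A? : Dec A) → ¬ A → ∀ x → [ does A? ]· x ≡ 0ℚ
[no]· A? ¬a x rewrite dec-false A? ¬a = refl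

private variable A B : Set

-- Opaque, so that unification never unfolds a sum into a fold over normalised rationals.
opaque
  ∑ : (A → ℚ) → List A → ℚ
  ∑ f xs = sumL (map f xs)

  ∑-[] : (f : A → ℚ) → ∑ f [] ≡ 0ℚ
  ∑-[] f = refl

  ∑-∷ : (f : A → ℚ) (x : A) (xs : List A) → ∑ f (x ∷ xs) ≡ f x + ∑ f xs
  ∑-∷ f x xs = refl

  ∑-[_] : (f : A → ℚ) (x : A) → ∑ f [ x ] ≡ f x
  ∑-[ f ] x = ℚ.+-identityʳ (f x)

  ∑-cong : {f g : A → ℚ} → (∀ x → f x ≡ g x) → ∀ xs → ∑ f xs ≡ ∑ g xs
  ∑-cong f≗g xs = cong sumL (List.map-cong f≗g xs)

  ∑-cong-local : {P : A → Set} {f g : A → ℚ} → (∀ x → P x → f x ≡ g x) →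
               ∀ {xs} → All P xs → ∑ f xs ≡ ∑ g xs
  ∑-cong-local f≗g [] = refl
  ∑-cong-local f≗g (px ∷ pxs) = cong₂ _+_ (f≗g _ px) (∑-cong-local f≗g pxs)

  ∑-zero : ∀ (xs : List A) → ∑ (λ _ → 0ℚ) xs ≡ 0ℚ
  ∑-zero [] = refl
  ∑-zero (x ∷ xs) = trans (ℚ.+-identityˡ _) (∑-zero xs)

  ∑-vanishing : {f : A → ℚ} → (∀ x → f x ≡ 0ℚ) → ∀ xs → ∑ f xs ≡ 0ℚ
  ∑-vanishing f≡0 xs = trans (∑-cong f≡0 xs) (∑-zero xs)

  ∑-+ : ∀ (f g : A → ℚ) xs → ∑ (λ x → f x + g x) xs ≡ ∑ f xs + ∑ g xs
  ∑-+ f g [] = refl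
  ∑-+ f g (x ∷ xs) rewrite ∑-+ f g xs =
    solve 4 (λ a b c d → (a :+ b) :+ (c :+ d) := (a :+ c) :+ (b :+ d)) refl
      (f x) (g x) (∑ f xs) (∑ g xs)
    where open ℚ-Solver

  ∑-*ˡ : ∀ c (f : A → ℚ) xs → ∑ (λ x → c * f x) xs ≡ c * ∑ f xs
  ∑-*ˡ c f [] = sym (ℚ.*-zeroʳ c)
  ∑-*ˡ c f (x ∷ xs) rewrite ∑-*ˡ c f xs = sym (ℚ.*-distribˡ-+ c (f x) (∑ f xs))

  ∑-*ʳ : ∀ c (f : A → ℚ) xs → ∑ (λ x → f x * c) xs ≡ ∑ f xs * c
  ∑-*ʳ c f [] = sym (ℚ.*-zeroˡ c)
  ∑-*ʳ c f (x ∷ xs) rewrite ∑-*ʳ c f xs = sym (ℚ.*-distribʳ-+ c (f x) (∑ f xs))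

  ∑-++ : ∀ (f : A → ℚ) xs ys → ∑ f (xs ++ ys) ≡ ∑ f xs + ∑ f ys
  ∑-++ f [] ys = sym (ℚ.+-identityˡ _)
  ∑-++ f (x ∷ xs) ys rewrite ∑-++ f xs ys = sym (ℚ.+-assoc (f x) _ _)

  ∑-[]· : ∀ b (f : A → ℚ) xs → ∑ (λ x → [ b ]· f x) xs ≡ [ b ]· ∑ f xs
  ∑-[]· true f xs = refl
  ∑-[]· false f xs = ∑-zero xs

  ∑-filter : ∀ {p} {P : A → Set p} (P? : ∀ x → Dec (P x)) (f : A → ℚ) xs →
             ∑ f (filter P? xs) ≡ ∑ (λ x → [ does (P? x) ]· f x) xs
  ∑-filter P? f [] = refl
  ∑-filter P? f (x ∷ xs) with does (P? x)
  ... | true = cong (f x +_) (∑-filter P? f xs)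
  ... | false = trans (∑-filter P? f xs) (sym (ℚ.+-identityˡ _))

  ∑-map : ∀ (f : B → ℚ) (g : A → B) xs → ∑ f (map g xs) ≡ ∑ (λ x → f (g x)) xs
  ∑-map f g xs = cong sumL (sym (List.map-∘ xs))

  ∑-concatMap : ∀ (f : B → ℚ) (g : A → List B) xs →
                ∑ f (concatMap g xs) ≡ ∑ (λ x → ∑ f (g x)) xs
  ∑-concatMap f g [] = refl
  ∑-concatMap f g (x ∷ xs) =
    trans (∑-++ f (g x) (concatMap g xs)) (cong (∑ f (g x) +_) (∑-concatMap f g xs))

  sumL-map≡∑ : ∀ (f : A → ℚ) xs → sumL (map f xs) ≡ ∑ f xs
  sumL-map≡∑ f xs = refl

∑-lincomb : ∀ a b (f g h : A → ℚ) xs →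
  ∑ (λ y → a * f y + b * g y + h y) xs ≡ a * ∑ f xs + b * ∑ g xs + ∑ h xs
∑-lincomb a b f g h xs =
  trans (∑-+ (λ y → a * f y + b * g y) h xs)
        (cong (_+ ∑ h xs) (trans (∑-+ (λ y → a * f y) (λ y → b * g y) xs)
                                 (cong₂ _+_ (∑-*ˡ a f xs) (∑-*ˡ b g xs))))

prodL-++ : ∀ xs ys → prodL (xs ++ ys) ≡ prodL xs * prodL ys
prodL-++ [] ys = sym (ℚ.*-identityˡ _)
prodL-++ (x ∷ xs) ys = trans (cong (x *_) (prodL-++ xs ys)) (sym (ℚ.*-assoc x (prodL xs) (prodL ys)))

-- Words and their decreasing trees

Letter : ℕ → ℕ → Set
Letter P x = 1 ≤ x × x ≤ P

WordOver : ℕ → Word → Set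
WordOver P = All (Letter P)

≤⇒≢suc : ∀ {x P} → x ≤ P → x ≢ suc P
≤⇒≢suc x≤P refl = ℕₚ.<-irrefl refl x≤P

≤suc-≢⇒≤ : ∀ {x P} → x ≤ suc P → x ≢ suc P → x ≤ P
≤suc-≢⇒≤ x≤1+P x≢1+P = ℕₚ.≤-pred (ℕₚ.≤∧≢⇒< x≤1+P x≢1+P)

oneTo-suc : ∀ P → oneTo (suc P) ≡ oneTo P ++ [ suc P ]
oneTo-suc P = trans (cong (map suc) (sym (List.upTo-∷ʳ P))) (List.map-++ suc (upTo P) [ P ])

letters-oneTo : ∀ P → WordOver P (oneTo P)
letters-oneTo zero = []
letters-oneTo (suc P) rewrite oneTo-suc P =
  All.++⁺ (All.map (λ (1≤x , x≤P) → 1≤x , ℕₚ.m≤n⇒m≤1+n x≤P) (letters-oneTo P))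
          ((s≤s z≤n , ℕₚ.≤-refl) ∷ [])

∑-oneTo-suc : ∀ P (f : ℕ → ℚ) → ∑ f (oneTo (suc P)) ≡ ∑ f (oneTo P) + f (suc P)
∑-oneTo-suc P f = begin
  ∑ f (oneTo (suc P))           ≡⟨ cong (∑ f) (oneTo-suc P) ⟩
  ∑ f (oneTo P ++ [ suc P ])    ≡⟨ ∑-++ f (oneTo P) [ suc P ] ⟩
  ∑ f (oneTo P) + ∑ f [ suc P ] ≡⟨ cong (∑ f (oneTo P) +_) (∑-[ f ] (suc P)) ⟩
  ∑ f (oneTo P) + f (suc P)     ∎
  where open ≡-Reasoning

∑Words : ℕ → ℕ → (Word → ℚ) → ℚ
∑Words P N F = ∑ F (wordsOver P N)

∑Words-zero : ∀ P F → ∑Words P 0 F ≡ F []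
∑Words-zero P F = ∑-[ F ] []

∑Words-suc : ∀ P N F →
  ∑Words P (suc N) F ≡ ∑ (λ x → ∑Words P N (λ w → F (x ∷ w))) (oneTo P)
∑Words-suc P N F =
  trans (∑-concatMap F (λ x → map (x ∷_) (wordsOver P N)) (oneTo P))
        (∑-cong (λ x → ∑-map F (x ∷_) (wordsOver P N)) (oneTo P))

∑Words-suc-alphabet : ∀ P N F → ∑Words (suc P) (suc N) F ≡
  ∑ (λ x → ∑Words (suc P) N (λ w → F (x ∷ w))) (oneTo P) + ∑Words (suc P) N (λ w → F (suc P ∷ w))
∑Words-suc-alphabet P N F = trans (∑Words-suc (suc P) N F) (∑-oneTo-suc P _)

∑Words-cong-on : ∀ P N {F G : Word → ℚ} →
  (∀ w → WordOver P w → length w ≡ N → F w ≡ G w) → ∑Words P N F ≡ ∑Words P N G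
∑Words-cong-on P zero {F} {G} F≗G =
  trans (∑Words-zero P F) (trans (F≗G [] [] refl) (sym (∑Words-zero P G)))
∑Words-cong-on P (suc N) {F} {G} F≗G = begin
  ∑Words P (suc N) F
    ≡⟨ ∑Words-suc P N F ⟩
  ∑ (λ x → ∑Words P N (λ w → F (x ∷ w))) (oneTo P)
    ≡⟨ ∑-cong-local (λ x x∈P → ∑Words-cong-on P N (λ w w∈P |w| →
                                 F≗G (x ∷ w) (x∈P ∷ w∈P) (cong suc |w|)))
                    (letters-oneTo P) ⟩
  ∑ (λ x → ∑Words P N (λ w → G (x ∷ w))) (oneTo P)
    ≡⟨ ∑Words-suc P N G ⟨
  ∑Words P (suc N) G ∎
  where open ≡-Reasoning

∑Words-cong : ∀ P N {F G : Word → ℚ} → (∀ w → F w ≡ G w) → ∑Words P N F ≡ ∑Words P N G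
∑Words-cong P N F≗G = ∑-cong F≗G (wordsOver P N)

∑Words-*ˡ : ∀ P N c F → ∑Words P N (λ w → c * F w) ≡ c * ∑Words P N F
∑Words-*ˡ P N c F = ∑-*ˡ c F (wordsOver P N)

∑Words-+ : ∀ P N F G → ∑Words P N (λ w → F w + G w) ≡ ∑Words P N F + ∑Words P N G
∑Words-+ P N F G = ∑-+ F G (wordsOver P N)

∑Words-[]· : ∀ P N b F → ∑Words P N (λ w → [ b ]· F w) ≡ [ b ]· ∑Words P N F
∑Words-[]· P N b F = ∑-[]· b F (wordsOver P N)

∑Words-vanishing : ∀ P N {F} → (∀ w → F w ≡ 0ℚ) → ∑Words P N F ≡ 0ℚ
∑Words-vanishing P N F≡0 = ∑-vanishing F≡0 (wordsOver P N)

consFirst : ℕ → List Word → List Word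
consFirst x [] = [ [ x ] ]
consFirst x (v ∷ ws) = (x ∷ v) ∷ ws

splitAt-≢ : ∀ m x w → x ≢ m → splitAt m (x ∷ w) ≡ consFirst x (splitAt m w)
splitAt-≢ m x w x≢m with x ℕ.≟ m | splitAt m w
... | yes x≡m | _ = ⊥-elim (x≢m x≡m)
... | no _ | [] = refl
... | no _ | v ∷ ws = refl

splitAt-≡ : ∀ m w → splitAt m (m ∷ w) ≡ [] ∷ splitAt m w
splitAt-≡ m w with m ℕ.≟ m
... | yes _ = refl
... | no m≢m = ⊥-elim (m≢m refl)

splitAt≢[] : ∀ m w → splitAt m w ≢ []
splitAt≢[] m (x ∷ w) with x ℕ.≟ m | splitAt m w
... | yes _ | _ = λ ()
... | no _ | [] = λ ()
... | no _ | _ ∷ _ = λ ()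

splitAt-free : ∀ m w → All (_≢ m) w → splitAt m w ≡ [ w ]
splitAt-free m [] [] = refl
splitAt-free m (x ∷ w) (x≢m ∷ w≢m) =
  trans (splitAt-≢ m x w x≢m) (cong (consFirst x) (splitAt-free m w w≢m))

join : ℕ → List Word → Word
join m [] = []
join m (w ∷ []) = w
join m (w ∷ w' ∷ ws) = w ++ m ∷ join m (w' ∷ ws)

join-consFirst : ∀ m x ws → join m (consFirst x ws) ≡ x ∷ join m ws
join-consFirst m x [] = refl
join-consFirst m x (v ∷ []) = refl
join-consFirst m x (v ∷ v' ∷ ws) = refl

join-[]∷ : ∀ m ws → ws ≢ [] → join m ([] ∷ ws) ≡ m ∷ join m ws
join-[]∷ m [] ws≢[] = ⊥-elim (ws≢[] refl)
join-[]∷ m (w ∷ ws) _ = refl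

join-splitAt : ∀ m w → join m (splitAt m w) ≡ w
join-splitAt m [] = refl
join-splitAt m (x ∷ w) = by-cases (x ℕ.≟ m)
  where
  open ≡-Reasoning
  by-cases : Dec (x ≡ m) → join m (splitAt m (x ∷ w)) ≡ x ∷ w
  by-cases (no x≢m) = begin
    join m (splitAt m (x ∷ w))           ≡⟨ cong (join m) (splitAt-≢ m x w x≢m) ⟩
    join m (consFirst x (splitAt m w))   ≡⟨ join-consFirst m x (splitAt m w) ⟩
    x ∷ join m (splitAt m w)             ≡⟨ cong (x ∷_) (join-splitAt m w) ⟩
    x ∷ w                                ∎
  by-cases (yes refl) = begin
    join m (splitAt m (m ∷ w))           ≡⟨ cong (join m) (splitAt-≡ m w) ⟩
    join m ([] ∷ splitAt m w)            ≡⟨ join-[]∷ m (splitAt m w) (splitAt≢[] m w) ⟩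
    m ∷ join m (splitAt m w)             ≡⟨ cong (m ∷_) (join-splitAt m w) ⟩
    m ∷ w                                ∎

consFirst-wordOver : ∀ {P x ws} → Letter P x → All (WordOver P) ws →
  All (WordOver P) (consFirst x ws)
consFirst-wordOver x∈P [] = (x∈P ∷ []) ∷ []
consFirst-wordOver x∈P (v∈P ∷ ws∈P) = (x∈P ∷ v∈P) ∷ ws∈P

splitAt-wordOver : ∀ P w → WordOver (suc P) w → All (WordOver P) (splitAt (suc P) w)
splitAt-wordOver P [] [] = [] ∷ []
splitAt-wordOver P (x ∷ w) ((1≤x , x≤1+P) ∷ w∈P) = by-cases (x ℕ.≟ suc P)
  where
  by-cases : Dec (x ≡ suc P) → All (WordOver P) (splitAt (suc P) (x ∷ w))
  by-cases (yes refl) =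
    subst (All (WordOver P)) (sym (splitAt-≡ (suc P) w)) ([] ∷ splitAt-wordOver P w w∈P)
  by-cases (no x≢1+P) =
    subst (All (WordOver P)) (sym (splitAt-≢ (suc P) x w x≢1+P))
          (consFirst-wordOver (1≤x , ≤suc-≢⇒≤ x≤1+P x≢1+P) (splitAt-wordOver P w w∈P))

buildSplit : ℕ → Word → List Word → PTree
buildSplit P w (w₀ ∷ w₁ ∷ ws) = node (build P w₀) (build P w₁) (map (build P) ws)
buildSplit P w _ = build P w

build-suc : ∀ P w → build (suc P) w ≡ buildSplit P w (splitAt (suc P) w)
build-suc P w with splitAt (suc P) w
... | [] = refl
... | _ ∷ [] = refl
... | _ ∷ _ ∷ _ = refl

build-[] : ∀ P → build P [] ≡ leaf
build-[] zero = refl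
build-[] (suc P) = build-[] P

wordOver-zero : ∀ w → WordOver 0 w → w ≡ []
wordOver-zero [] _ = refl
wordOver-zero (x ∷ w) ((1≤x , x≤0) ∷ _) = ⊥-elim (ℕₚ.<⇒≱ 1≤x x≤0)

letters≤maxL : ∀ w → All (_≤ maxL w) w
letters≤maxL [] = []
letters≤maxL (x ∷ w) =
  ℕₚ.m≤m⊔n x (maxL w) ∷
  All.map (λ y≤ → ℕₚ.≤-trans y≤ (ℕₚ.m≤n⊔m x (maxL w))) (letters≤maxL w)

maxL≤ : ∀ K w → WordOver K w → maxL w ≤ K
maxL≤ K [] [] = z≤n
maxL≤ K (x ∷ w) ((_ , x≤K) ∷ w∈K) = ℕₚ.⊔-lub x≤K (maxL≤ K w w∈K)

build-above-maxL : ∀ K w → maxL w ≤ K → build K w ≡ 𝒯 w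
build-above-maxL zero w max≤0 rewrite ℕₚ.n≤0⇒n≡0 max≤0 = refl
build-above-maxL (suc K) w max≤1+K with maxL w ℕ.≟ suc K
... | yes max≡1+K = cong (λ m → build m w) (sym max≡1+K)
... | no max≢1+K = begin
  build (suc K) w
    ≡⟨ build-suc K w ⟩
  buildSplit K w (splitAt (suc K) w)
    ≡⟨ cong (buildSplit K w) (splitAt-free (suc K) w (All.map ≢1+K (letters≤maxL w))) ⟩
  build K w
    ≡⟨ build-above-maxL K w max≤K ⟩
  𝒯 w ∎
  where
  open ≡-Reasoning
  max≤K = ≤suc-≢⇒≤ max≤1+K max≢1+K
  ≢1+K : ∀ {x} → x ≤ maxL w → x ≢ suc K
  ≢1+K x≤max = ≤⇒≢suc (ℕₚ.≤-trans x≤max max≤K)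

length-join : ∀ P m w₀ ws → All (λ w → length w ≡ regions (build P w)) (w₀ ∷ ws) →
  length (join m (w₀ ∷ ws)) ≡ length ws ℕ.+ regionsL (map (build P) (w₀ ∷ ws))
length-join P m w₀ [] (|w₀| ∷ []) = trans |w₀| (sym (ℕₚ.+-identityʳ _))
length-join P m w₀ (w₁ ∷ ws) (|w₀| ∷ |ws|) = begin
  length (w₀ ++ m ∷ join m (w₁ ∷ ws))
    ≡⟨ List.length-++ w₀ ⟩
  length w₀ ℕ.+ suc (length (join m (w₁ ∷ ws)))
    ≡⟨ cong₂ (λ a b → a ℕ.+ suc b) |w₀| (length-join P m w₁ ws |ws|) ⟩
  r₀ ℕ.+ suc (length ws ℕ.+ rs)
    ≡⟨ solve 3 (λ a b c → a :+ (con 1 :+ (b :+ c)) := (con 1 :+ b) :+ (a :+ c)) refl r₀ (length ws) rs ⟩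
  suc (length ws) ℕ.+ (r₀ ℕ.+ rs) ∎
  where
  open ≡-Reasoning
  open ℕ-Solver
  r₀ = regions (build P w₀)
  rs = regionsL (map (build P) (w₁ ∷ ws))

length-build : ∀ P w → WordOver P w → length w ≡ regions (build P w)
length-build zero w w∈P rewrite wordOver-zero w w∈P = refl
length-build (suc P) w w∈P =
  trans (by-split (splitAt (suc P) w) refl) (cong regions (sym (build-suc P w)))
  where
  join≡w : ∀ {ws} → splitAt (suc P) w ≡ ws → join (suc P) ws ≡ w
  join≡w split≡ws = trans (cong (join (suc P)) (sym split≡ws)) (join-splitAt (suc P) w)
  by-split : ∀ ws → splitAt (suc P) w ≡ ws → length w ≡ regions (buildSplit P w ws)
  by-split [] split≡[] = ⊥-elim (splitAt≢[] (suc P) w split≡[])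
  by-split (w₀ ∷ ws) split≡ with subst (All (WordOver P)) split≡ (splitAt-wordOver P w w∈P)
  by-split (w₀ ∷ []) split≡ | w₀∈P ∷ [] = length-build P w (subst (WordOver P) (join≡w split≡) w₀∈P)
  by-split (w₀ ∷ w₁ ∷ ws) split≡ | ws∈P = begin
    length w
      ≡⟨ cong length (join≡w split≡) ⟨
    length (join (suc P) (w₀ ∷ w₁ ∷ ws))
      ≡⟨ length-join P (suc P) w₀ (w₁ ∷ ws) (All.map (λ {v} → length-build P v) ws∈P) ⟩
    suc (length ws) ℕ.+ regionsL (map (build P) (w₀ ∷ w₁ ∷ ws))
      ≡⟨ cong (λ n → suc n ℕ.+ regionsL (map (build P) (w₀ ∷ w₁ ∷ ws))) (List.length-map (build P) ws) ⟨
    regions (buildSplit P w (w₀ ∷ w₁ ∷ ws)) ∎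
    where open ≡-Reasoning

FirstBlockLength : ℕ → ℕ → (List Word → ℚ) → Set
FirstBlockLength P a K =
  ∀ v₀ ws → All (WordOver P) (v₀ ∷ ws) → length v₀ ≢ a → K (v₀ ∷ ws) ≡ 0ℚ

firstBlockLength-consFirst : ∀ {P a x K} → Letter P x → FirstBlockLength P (suc a) K →
  FirstBlockLength P a (λ ws → K (consFirst x ws))
firstBlockLength-consFirst {x = x} x∈P K-van v₀ ws (v₀∈P ∷ ws∈P) |v₀|≢a =
  K-van (x ∷ v₀) ws ((x∈P ∷ v₀∈P) ∷ ws∈P) (|v₀|≢a ∘ ℕₚ.suc-injective)

∑Words-split-single : ∀ P a (K : List Word → ℚ) → FirstBlockLength P a K →
  ∑Words (suc P) a (λ v → K (splitAt (suc P) v)) ≡ ∑Words P a (λ v₀ → K [ v₀ ])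
∑Words-split-single P zero K K-van =
  trans (∑Words-zero (suc P) (λ v → K (splitAt (suc P) v))) (sym (∑Words-zero P (λ v₀ → K [ v₀ ])))
∑Words-split-single P (suc a) K K-van = begin
  ∑Words (suc P) (suc a) (λ v → K (splitAt (suc P) v))
    ≡⟨ ∑Words-suc-alphabet P a _ ⟩
  ∑ (λ x → ∑Words (suc P) a (λ w → K (splitAt (suc P) (x ∷ w)))) (oneTo P)
    + ∑Words (suc P) a (λ w → K (splitAt (suc P) (suc P ∷ w)))
    ≡⟨ cong₂ _+_ (∑-cong-local non-maximal (letters-oneTo P))
                 (∑Words-cong-on (suc P) a maximal) ⟩
  Lower + ∑Words (suc P) a (λ _ → 0ℚ)
    ≡⟨ cong (Lower +_) (∑Words-vanishing (suc P) a (λ _ → refl)) ⟩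
  Lower + 0ℚ
    ≡⟨ trans (ℚ.+-identityʳ Lower) (sym (∑Words-suc P a _)) ⟩
  ∑Words P (suc a) (λ v₀ → K [ v₀ ]) ∎
  where
  open ≡-Reasoning
  Lower = ∑ (λ x → ∑Words P a (λ v₀ → K [ x ∷ v₀ ])) (oneTo P)
  non-maximal : ∀ x → Letter P x →
    ∑Words (suc P) a (λ w → K (splitAt (suc P) (x ∷ w))) ≡ ∑Words P a (λ v₀ → K [ x ∷ v₀ ])
  non-maximal x x∈P = trans
    (∑Words-cong (suc P) a (λ w → cong K (splitAt-≢ (suc P) x w (≤⇒≢suc (proj₂ x∈P)))))
    (∑Words-split-single P a (λ ws → K (consFirst x ws)) (firstBlockLength-consFirst {K = K} x∈P K-van))
  maximal : ∀ w → WordOver (suc P) w → length w ≡ a → K (splitAt (suc P) (suc P ∷ w)) ≡ 0ℚ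
  maximal w w∈P _ = trans (cong K (splitAt-≡ (suc P) w))
                          (K-van [] _ ([] ∷ splitAt-wordOver P w w∈P) (λ ()))

∑Words-split-first : ∀ P a M (K : List Word → ℚ) → FirstBlockLength P a K →
  ∑Words (suc P) (a ℕ.+ suc M) (λ v → K (splitAt (suc P) v)) ≡
  ∑Words P a (λ v₀ → ∑Words (suc P) M (λ v → K (v₀ ∷ splitAt (suc P) v)))
∑Words-split-first P zero M K K-van = begin
  ∑Words (suc P) (suc M) (λ v → K (splitAt (suc P) v))
    ≡⟨ ∑Words-suc-alphabet P M _ ⟩
  ∑ (λ x → ∑Words (suc P) M (λ w → K (splitAt (suc P) (x ∷ w)))) (oneTo P)
    + ∑Words (suc P) M (λ w → K (splitAt (suc P) (suc P ∷ w)))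
    ≡⟨ cong₂ _+_ (∑-cong-local (λ x x∈P → ∑Words-cong-on (suc P) M (non-maximal x x∈P)) (letters-oneTo P))
                 (∑Words-cong (suc P) M (λ w → cong K (splitAt-≡ (suc P) w))) ⟩
  ∑ (λ x → ∑Words (suc P) M (λ _ → 0ℚ)) (oneTo P) + Rest
    ≡⟨ cong (_+ Rest) (∑-vanishing (λ x → ∑Words-vanishing (suc P) M (λ _ → refl)) (oneTo P)) ⟩
  0ℚ + Rest
    ≡⟨ trans (ℚ.+-identityˡ Rest) (sym (∑Words-zero P _)) ⟩
  ∑Words P zero (λ v₀ → ∑Words (suc P) M (λ v → K (v₀ ∷ splitAt (suc P) v))) ∎
  where
  open ≡-Reasoning
  Rest = ∑Words (suc P) M (λ v → K ([] ∷ splitAt (suc P) v))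
  non-maximal : ∀ x → Letter P x → ∀ w → WordOver (suc P) w → length w ≡ M →
    K (splitAt (suc P) (x ∷ w)) ≡ 0ℚ
  non-maximal x x∈P w w∈P _ =
    trans (cong K (splitAt-≢ (suc P) x w (≤⇒≢suc (proj₂ x∈P))))
          (first-block-nonempty (splitAt (suc P) w) (splitAt-wordOver P w w∈P))
    where
    first-block-nonempty : ∀ ws → All (WordOver P) ws → K (consFirst x ws) ≡ 0ℚ
    first-block-nonempty [] [] = K-van [ x ] [] ((x∈P ∷ []) ∷ []) (λ ())
    first-block-nonempty (v ∷ ws) (v∈P ∷ ws∈P) = K-van (x ∷ v) ws ((x∈P ∷ v∈P) ∷ ws∈P) (λ ())
∑Words-split-first P (suc a) M K K-van = begin
  ∑Words (suc P) (suc (a ℕ.+ suc M)) (λ v → K (splitAt (suc P) v))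
    ≡⟨ ∑Words-suc-alphabet P (a ℕ.+ suc M) _ ⟩
  ∑ (λ x → ∑Words (suc P) (a ℕ.+ suc M) (λ w → K (splitAt (suc P) (x ∷ w)))) (oneTo P)
    + ∑Words (suc P) (a ℕ.+ suc M) (λ w → K (splitAt (suc P) (suc P ∷ w)))
    ≡⟨ cong₂ _+_ (∑-cong-local non-maximal (letters-oneTo P))
                 (∑Words-cong-on (suc P) (a ℕ.+ suc M) maximal) ⟩
  Lower + ∑Words (suc P) (a ℕ.+ suc M) (λ _ → 0ℚ)
    ≡⟨ cong (Lower +_) (∑Words-vanishing (suc P) (a ℕ.+ suc M) (λ _ → refl)) ⟩
  Lower + 0ℚ
    ≡⟨ trans (ℚ.+-identityʳ Lower) (sym (∑Words-suc P a _)) ⟩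
  ∑Words P (suc a) (λ v₀ → ∑Words (suc P) M (λ v → K (v₀ ∷ splitAt (suc P) v))) ∎
  where
  open ≡-Reasoning
  Lower = ∑ (λ x → ∑Words P a (λ v₀ → ∑Words (suc P) M (λ v → K ((x ∷ v₀) ∷ splitAt (suc P) v))))
            (oneTo P)
  non-maximal : ∀ x → Letter P x →
    ∑Words (suc P) (a ℕ.+ suc M) (λ w → K (splitAt (suc P) (x ∷ w))) ≡
    ∑Words P a (λ v₀ → ∑Words (suc P) M (λ v → K ((x ∷ v₀) ∷ splitAt (suc P) v)))
  non-maximal x x∈P = trans
    (∑Words-cong (suc P) (a ℕ.+ suc M) (λ w → cong K (splitAt-≢ (suc P) x w (≤⇒≢suc (proj₂ x∈P)))))
    (∑Words-split-first P a M (λ ws → K (consFirst x ws)) (firstBlockLength-consFirst {K = K} x∈P K-van))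
  maximal : ∀ w → WordOver (suc P) w → length w ≡ a ℕ.+ suc M →
    K (splitAt (suc P) (suc P ∷ w)) ≡ 0ℚ
  maximal w w∈P _ = trans (cong K (splitAt-≡ (suc P) w))
                          (K-van [] _ ([] ∷ splitAt-wordOver P w w∈P) (λ ()))

-- Sums over words with prescribed trees

hasTree : ℕ → PTree → Word → Bool
hasTree P T v = does (build P v ≟ᵀ T)

∑Tree : ℕ → PTree → (Word → ℚ) → ℚ
∑Tree P T H = ∑Words P (regions T) (λ v → [ hasTree P T v ]· H v)

∑Tree-cong-on : ∀ P T {H H′ : Word → ℚ} →
  (∀ v → WordOver P v → length v ≡ regions T → H v ≡ H′ v) → ∑Tree P T H ≡ ∑Tree P T H′
∑Tree-cong-on P T H≗H′ =
  ∑Words-cong-on P (regions T) (λ v v∈P |v| → cong ([ hasTree P T v ]·_) (H≗H′ v v∈P |v|))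

∑Tree-cong : ∀ P T {H H′ : Word → ℚ} → (∀ v → H v ≡ H′ v) → ∑Tree P T H ≡ ∑Tree P T H′
∑Tree-cong P T H≗H′ = ∑Words-cong P (regions T) (λ v → cong ([ hasTree P T v ]·_) (H≗H′ v))

∑Tree-*ˡ : ∀ P T c H → ∑Tree P T (λ v → c * H v) ≡ c * ∑Tree P T H
∑Tree-*ˡ P T c H =
  trans (∑Words-cong P (regions T) (λ v → []·-*-comm (hasTree P T v) c (H v))) (∑Words-*ˡ P (regions T) c _)

∑Tree-+ : ∀ P T H H′ → ∑Tree P T (λ v → H v + H′ v) ≡ ∑Tree P T H + ∑Tree P T H′
∑Tree-+ P T H H′ =
  trans (∑Words-cong P (regions T) (λ v → []·-+ (hasTree P T v) (H v) (H′ v))) (∑Words-+ P (regions T) _ _)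

∑Tree-zero : ∀ P T → ∑Tree P T (λ _ → 0ℚ) ≡ 0ℚ
∑Tree-zero P T = ∑Words-vanishing P (regions T) (λ v → []·-zero (hasTree P T v))

∑Tree-leaf : ∀ P H → ∑Tree P leaf H ≡ H []
∑Tree-leaf P H = trans (∑Words-zero P _) ([yes]· (build P [] ≟ᵀ leaf) (build-[] P) (H []))

∑Concat : ℕ → List PTree → (Word → ℚ) → ℚ
∑Concat P [] K = K []
∑Concat P (T ∷ Fs) K = ∑Tree P T (λ v → ∑Concat P Fs (λ w → K (v ++ w)))

∑Concat-cong : ∀ P Fs {K K′ : Word → ℚ} → (∀ w → K w ≡ K′ w) → ∑Concat P Fs K ≡ ∑Concat P Fs K′
∑Concat-cong P [] K≗K′ = K≗K′ []
∑Concat-cong P (T ∷ Fs) K≗K′ = ∑Tree-cong P T (λ v → ∑Concat-cong P Fs (λ w → K≗K′ (v ++ w)))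

∑Concat-cong-on : ∀ P Fs {K K′ : Word → ℚ} →
  (∀ w → WordOver P w → length w ≡ regionsL Fs → K w ≡ K′ w) → ∑Concat P Fs K ≡ ∑Concat P Fs K′
∑Concat-cong-on P [] K≗K′ = K≗K′ [] [] refl
∑Concat-cong-on P (T ∷ Fs) K≗K′ = ∑Tree-cong-on P T (λ v v∈P |v| → ∑Concat-cong-on P Fs (λ w w∈P |w| →
  K≗K′ (v ++ w) (All.++⁺ v∈P w∈P) (trans (List.length-++ v) (cong₂ ℕ._+_ |v| |w|))))

∑Concat-*ˡ : ∀ P Fs c K → ∑Concat P Fs (λ w → c * K w) ≡ c * ∑Concat P Fs K
∑Concat-*ˡ P [] c K = refl
∑Concat-*ˡ P (T ∷ Fs) c K =
  trans (∑Tree-cong P T (λ v → ∑Concat-*ˡ P Fs c (λ w → K (v ++ w)))) (∑Tree-*ˡ P T c _)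

∑Concat-+ : ∀ P Fs K K′ → ∑Concat P Fs (λ w → K w + K′ w) ≡ ∑Concat P Fs K + ∑Concat P Fs K′
∑Concat-+ P [] K K′ = refl
∑Concat-+ P (T ∷ Fs) K K′ =
  trans (∑Tree-cong P T (λ v → ∑Concat-+ P Fs (λ w → K (v ++ w)) (λ w → K′ (v ++ w)))) (∑Tree-+ P T _ _)

∑Concat-zero : ∀ P Fs → ∑Concat P Fs (λ _ → 0ℚ) ≡ 0ℚ
∑Concat-zero P [] = refl
∑Concat-zero P (T ∷ Fs) = trans (∑Tree-cong P T (λ v → ∑Concat-zero P Fs)) (∑Tree-zero P T)

∑Concat-∑ : ∀ P Fs (g : Word → A → ℚ) xs →
  ∑Concat P Fs (λ w → ∑ (g w) xs) ≡ ∑ (λ x → ∑Concat P Fs (λ w → g w x)) xs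
∑Concat-∑ P Fs g [] = begin
  ∑Concat P Fs (λ w → ∑ (g w) [])              ≡⟨ ∑Concat-cong P Fs (λ w → ∑-[] (g w)) ⟩
  ∑Concat P Fs (λ _ → 0ℚ)                      ≡⟨ ∑Concat-zero P Fs ⟩
  0ℚ                                           ≡⟨ ∑-[] _ ⟨
  ∑ (λ x → ∑Concat P Fs (λ w → g w x)) []      ∎
  where open ≡-Reasoning
∑Concat-∑ P Fs g (x ∷ xs) = begin
  ∑Concat P Fs (λ w → ∑ (g w) (x ∷ xs))
    ≡⟨ ∑Concat-cong P Fs (λ w → ∑-∷ (g w) x xs) ⟩
  ∑Concat P Fs (λ w → g w x + ∑ (g w) xs)
    ≡⟨ ∑Concat-+ P Fs (λ w → g w x) (λ w → ∑ (g w) xs) ⟩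
  ∑Concat P Fs (λ w → g w x) + ∑Concat P Fs (λ w → ∑ (g w) xs)
    ≡⟨ cong (∑Concat P Fs (λ w → g w x) +_) (∑Concat-∑ P Fs g xs) ⟩
  ∑Concat P Fs (λ w → g w x) + ∑ (λ y → ∑Concat P Fs (λ w → g w y)) xs
    ≡⟨ ∑-∷ _ x xs ⟨
  ∑ (λ y → ∑Concat P Fs (λ w → g w y)) (x ∷ xs) ∎
  where open ≡-Reasoning

∑Concat-++ : ∀ P Fs Gs K → ∑Concat P (Fs ++ Gs) K ≡ ∑Concat P Fs (λ v → ∑Concat P Gs (λ w → K (v ++ w)))
∑Concat-++ P [] Gs K = refl
∑Concat-++ P (T ∷ Fs) Gs K = ∑Tree-cong P T (λ v → trans (∑Concat-++ P Fs Gs (λ w → K (v ++ w)))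
  (∑Concat-cong P Fs (λ u → ∑Concat-cong P Gs (λ w → cong K (sym (List.++-assoc v u w))))))

∑Concat-lincomb : ∀ P Fs a b K₁ K₂ K₃ →
  ∑Concat P Fs (λ w → a * K₁ w + b * K₂ w + K₃ w) ≡
  a * ∑Concat P Fs K₁ + b * ∑Concat P Fs K₂ + ∑Concat P Fs K₃
∑Concat-lincomb P Fs a b K₁ K₂ K₃ =
  trans (∑Concat-+ P Fs (λ w → a * K₁ w + b * K₂ w) K₃)
        (cong (_+ ∑Concat P Fs K₃) (trans (∑Concat-+ P Fs (λ w → a * K₁ w) (λ w → b * K₂ w))
                                          (cong₂ _+_ (∑Concat-*ˡ P Fs a K₁) (∑Concat-*ˡ P Fs b K₂))))

regionsL≡0⇒leaves : ∀ Fs → regionsL Fs ≡ 0 → All (_≡ leaf) Fs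
regionsL≡0⇒leaves [] _ = []
regionsL≡0⇒leaves (leaf ∷ Fs) r≡0 = refl ∷ regionsL≡0⇒leaves Fs r≡0

∑Concat-leaves : ∀ P Fs K → All (_≡ leaf) Fs → ∑Concat P Fs K ≡ K []
∑Concat-leaves P [] K [] = refl
∑Concat-leaves P (.leaf ∷ Fs) K (refl ∷ leaves) =
  trans (∑Tree-leaf P _) (∑Concat-leaves P Fs K leaves)

∑Concat-empty-alphabet : ∀ Fs K → regionsL Fs ≢ 0 → ∑Concat 0 Fs K ≡ 0ℚ
∑Concat-empty-alphabet [] K r≢0 = ⊥-elim (r≢0 refl)
∑Concat-empty-alphabet (leaf ∷ Fs) K r≢0 =
  trans (∑Tree-leaf 0 _) (∑Concat-empty-alphabet Fs (λ w → K ([] ++ w)) r≢0)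
∑Concat-empty-alphabet (node T₀ T₁ Ts ∷ Fs) K _ = ∑-[] _

∑Join : ℕ → List PTree → (Word → ℚ) → ℚ
∑Join P [] H = H []
∑Join P (U ∷ []) H = ∑Tree P U H
∑Join P (U ∷ U′ ∷ Us) H = ∑Tree P U (λ v → ∑Join P (U′ ∷ Us) (λ w → H (v ++ suc P ∷ w)))

∑Join-cong : ∀ P Us {H H′ : Word → ℚ} → (∀ w → H w ≡ H′ w) → ∑Join P Us H ≡ ∑Join P Us H′
∑Join-cong P [] H≗H′ = H≗H′ []
∑Join-cong P (U ∷ []) H≗H′ = ∑Tree-cong P U H≗H′
∑Join-cong P (U ∷ U′ ∷ Us) H≗H′ =
  ∑Tree-cong P U (λ v → ∑Join-cong P (U′ ∷ Us) (λ w → H≗H′ (v ++ suc P ∷ w)))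

∑Join-*ˡ : ∀ P Us c H → ∑Join P Us (λ w → c * H w) ≡ c * ∑Join P Us H
∑Join-*ˡ P [] c H = refl
∑Join-*ˡ P (U ∷ []) c H = ∑Tree-*ˡ P U c H
∑Join-*ˡ P (U ∷ U′ ∷ Us) c H =
  trans (∑Tree-cong P U (λ v → ∑Join-*ˡ P (U′ ∷ Us) c _)) (∑Tree-*ˡ P U c _)

joinedLength : List PTree → ℕ
joinedLength [] = 0
joinedLength (U ∷ []) = regions U
joinedLength (U ∷ U′ ∷ Us) = regions U ℕ.+ suc (joinedLength (U′ ∷ Us))

joinedLength-∷ : ∀ U Us → joinedLength (U ∷ Us) ≡ length Us ℕ.+ regionsL (U ∷ Us)
joinedLength-∷ U [] = sym (ℕₚ.+-identityʳ _)
joinedLength-∷ U (U′ ∷ Us) rewrite joinedLength-∷ U′ Us =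
  solve 3 (λ a b c → a :+ (con 1 :+ (b :+ c)) := (con 1 :+ b) :+ (a :+ c)) refl
    (regions U) (length Us) (regionsL (U′ ∷ Us))
  where open ℕ-Solver

does-≟ᴸ-∷ : ∀ t ts u us → does ((t ∷ ts) ≟ᴸ (u ∷ us)) ≡ does (t ≟ᵀ u) ∧ does (ts ≟ᴸ us)
does-≟ᴸ-∷ t ts u us = does-⇔
  (mk⇔ (λ e → List.∷-injectiveˡ e , List.∷-injectiveʳ e) (λ (t≡u , ts≡us) → cong₂ _∷_ t≡u ts≡us))
  ((t ∷ ts) ≟ᴸ (u ∷ us)) ((t ≟ᵀ u) ×-dec (ts ≟ᴸ us))

blockWeight : ℕ → List PTree → (Word → ℚ) → List Word → ℚ
blockWeight P Us H ws = [ does (map (build P) ws ≟ᴸ Us) ]· H (join (suc P) ws)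

blockWeight-firstBlockLength : ∀ P U Us H → FirstBlockLength P (regions U) (blockWeight P (U ∷ Us) H)
blockWeight-firstBlockLength P U Us H v₀ ws (v₀∈P ∷ _) |v₀|≢r =
  [no]· (map (build P) (v₀ ∷ ws) ≟ᴸ (U ∷ Us))
        (λ e → |v₀|≢r (trans (length-build P v₀ v₀∈P) (cong regions (List.∷-injectiveˡ e)))) _

blockWeight-∷ : ∀ P U Us H v₀ ws → ws ≢ [] →
  blockWeight P (U ∷ Us) H (v₀ ∷ ws) ≡
  [ hasTree P U v₀ ]· blockWeight P Us (λ w → H (v₀ ++ suc P ∷ w)) ws
blockWeight-∷ P U Us H v₀ [] ws≢[] = ⊥-elim (ws≢[] refl)
blockWeight-∷ P U Us H v₀ (w ∷ ws) _
  rewrite does-≟ᴸ-∷ (build P v₀) (map (build P) (w ∷ ws)) U Us =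
  sym ([]·-∧ (hasTree P U v₀) (does (map (build P) (w ∷ ws) ≟ᴸ Us)) (H (join (suc P) (v₀ ∷ w ∷ ws))))

∑Words-blockWeight : ∀ P U Us H →
  ∑Words (suc P) (joinedLength (U ∷ Us)) (λ v → blockWeight P (U ∷ Us) H (splitAt (suc P) v)) ≡
  ∑Join P (U ∷ Us) H
∑Words-blockWeight P U [] H =
  trans (∑Words-split-single P (regions U) (blockWeight P [ U ] H) (blockWeight-firstBlockLength P U [] H))
        (∑Words-cong P (regions U) single)
  where
  single : ∀ v₀ → blockWeight P [ U ] H [ v₀ ] ≡ [ hasTree P U v₀ ]· H v₀
  single v₀ rewrite does-≟ᴸ-∷ (build P v₀) [] U [] | ∧-identityʳ (hasTree P U v₀) = refl
∑Words-blockWeight P U (U′ ∷ Us) H =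
  trans (∑Words-split-first P (regions U) M (blockWeight P (U ∷ U′ ∷ Us) H)
                            (blockWeight-firstBlockLength P U (U′ ∷ Us) H))
        (∑Words-cong P (regions U) first)
  where
  M = joinedLength (U′ ∷ Us)
  first : ∀ v₀ →
    ∑Words (suc P) M (λ v → blockWeight P (U ∷ U′ ∷ Us) H (v₀ ∷ splitAt (suc P) v)) ≡
    [ hasTree P U v₀ ]· ∑Join P (U′ ∷ Us) (λ w → H (v₀ ++ suc P ∷ w))
  first v₀ = begin
    ∑Words (suc P) M (λ v → blockWeight P (U ∷ U′ ∷ Us) H (v₀ ∷ splitAt (suc P) v))
      ≡⟨ ∑Words-cong (suc P) M (λ v → blockWeight-∷ P U (U′ ∷ Us) H v₀ (splitAt (suc P) v)
                                                     (splitAt≢[] (suc P) v)) ⟩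
    ∑Words (suc P) M (λ v → [ hasTree P U v₀ ]· Rest v)
      ≡⟨ ∑Words-[]· (suc P) M (hasTree P U v₀) Rest ⟩
    [ hasTree P U v₀ ]· ∑Words (suc P) M Rest
      ≡⟨ cong ([ hasTree P U v₀ ]·_) (∑Words-blockWeight P U′ Us H′) ⟩
    [ hasTree P U v₀ ]· ∑Join P (U′ ∷ Us) H′ ∎
    where
    open ≡-Reasoning
    H′ = λ w → H (v₀ ++ suc P ∷ w)
    Rest = λ v → blockWeight P (U′ ∷ Us) H′ (splitAt (suc P) v)

node≡⇔children≡ : ∀ {l r ts l′ r′ ts′} →
  (node l r ts ≡ node l′ r′ ts′) ⇔ (children l r ts ≡ children l′ r′ ts′)
node≡⇔children≡ = mk⇔ (λ { refl → refl }) (λ { refl → refl })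

buildSplit-≟-node : ∀ P v ws T₀ T₁ Ts X → join (suc P) ws ≡ v → ws ≢ [] →
  [ does (buildSplit P v ws ≟ᵀ node T₀ T₁ Ts) ]· X ≡
  [ does (map (build P) ws ≟ᴸ [ node T₀ T₁ Ts ]) ]· X +
  [ does (map (build P) ws ≟ᴸ (T₀ ∷ T₁ ∷ Ts)) ]· X
buildSplit-≟-node P v [] T₀ T₁ Ts X _ ws≢[] = ⊥-elim (ws≢[] refl)
buildSplit-≟-node P .w₀ (w₀ ∷ []) T₀ T₁ Ts X refl _
  rewrite does-≟ᴸ-∷ (build P w₀) [] (node T₀ T₁ Ts) []
        | does-≟ᴸ-∷ (build P w₀) [] T₀ (T₁ ∷ Ts)
        | ∧-identityʳ (does (build P w₀ ≟ᵀ node T₀ T₁ Ts))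
        | ∧-zeroʳ (does (build P w₀ ≟ᵀ T₀))
  = sym (ℚ.+-identityʳ _)
buildSplit-≟-node P v (w₀ ∷ w₁ ∷ ws) T₀ T₁ Ts X _ _
  rewrite does-≟ᴸ-∷ (build P w₀) (map (build P) (w₁ ∷ ws)) (node T₀ T₁ Ts) []
        | ∧-zeroʳ (does (build P w₀ ≟ᵀ node T₀ T₁ Ts))
  = trans (cong ([_]· X) (does-⇔ node≡⇔children≡ (buildSplit P v (w₀ ∷ w₁ ∷ ws) ≟ᵀ node T₀ T₁ Ts)
                                                 (map (build P) (w₀ ∷ w₁ ∷ ws) ≟ᴸ (T₀ ∷ T₁ ∷ Ts))))
          (sym (ℚ.+-identityˡ ([ does (map (build P) (w₀ ∷ w₁ ∷ ws) ≟ᴸ (T₀ ∷ T₁ ∷ Ts)) ]· X)))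

-- A word over {1, …, P + 1} whose tree is a node either avoids P + 1, or P + 1 labels the
-- root and the word is a join, with separator P + 1, of words for the root subtrees.
∑Tree-suc-node : ∀ P T₀ T₁ Ts H →
  ∑Tree (suc P) (node T₀ T₁ Ts) H ≡ ∑Tree P (node T₀ T₁ Ts) H + ∑Join P (T₀ ∷ T₁ ∷ Ts) H
∑Tree-suc-node P T₀ T₁ Ts H = begin
  ∑Tree (suc P) T H
    ≡⟨ ∑Words-cong (suc P) (regions T) at-root ⟩
  ∑Words (suc P) (regions T) (λ v → Whole (splitAt (suc P) v) + Below (splitAt (suc P) v))
    ≡⟨ ∑Words-+ (suc P) (regions T) (λ v → Whole (splitAt (suc P) v)) (λ v → Below (splitAt (suc P) v)) ⟩
  ∑Words (suc P) (regions T) (λ v → Whole (splitAt (suc P) v)) +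
  ∑Words (suc P) (regions T) (λ v → Below (splitAt (suc P) v))
    ≡⟨ cong₂ _+_ (∑Words-blockWeight P T [] H)
                 (trans (cong (λ N → ∑Words (suc P) N (λ v → Below (splitAt (suc P) v)))
                              (sym (joinedLength-∷ T₀ (T₁ ∷ Ts))))
                        (∑Words-blockWeight P T₀ (T₁ ∷ Ts) H)) ⟩
  ∑Tree P T H + ∑Join P (T₀ ∷ T₁ ∷ Ts) H ∎
  where
  open ≡-Reasoning
  T = node T₀ T₁ Ts
  Whole = blockWeight P [ T ] H
  Below = blockWeight P (T₀ ∷ T₁ ∷ Ts) H
  at-root : ∀ v → [ hasTree (suc P) T v ]· H v ≡ Whole (splitAt (suc P) v) + Below (splitAt (suc P) v)
  at-root v = begin
    [ hasTree (suc P) T v ]· H v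
      ≡⟨ cong₂ (λ U w → [ does (U ≟ᵀ T) ]· H w) (build-suc P v) (sym (join-splitAt (suc P) v)) ⟩
    [ does (buildSplit P v (splitAt (suc P) v) ≟ᵀ T) ]· H (join (suc P) (splitAt (suc P) v))
      ≡⟨ buildSplit-≟-node P v (splitAt (suc P) v) T₀ T₁ Ts _ (join-splitAt (suc P) v) (splitAt≢[] (suc P) v) ⟩
    Whole (splitAt (suc P) v) + Below (splitAt (suc P) v) ∎

-- Erasing the maximal letter

erase : ℕ → Word → Word
erase m [] = []
erase m (x ∷ w) = if does (x ℕ.≟ m) then erase m w else x ∷ erase m w

countL-++ : ∀ m u w → countL m (u ++ w) ≡ countL m u ℕ.+ countL m w
countL-++ m [] w = refl
countL-++ m (x ∷ u) w with does (x ℕ.≟ m)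
... | true = cong suc (countL-++ m u w)
... | false = countL-++ m u w

countL-free : ∀ P v → WordOver P v → countL (suc P) v ≡ 0
countL-free P [] [] = refl
countL-free P (x ∷ v) ((_ , x≤P) ∷ v∈P) rewrite dec-false (x ℕ.≟ suc P) (≤⇒≢suc x≤P) =
  countL-free P v v∈P

countL-head : ∀ m w → countL m (m ∷ w) ≡ suc (countL m w)
countL-head m w rewrite dec-true (m ℕ.≟ m) refl = refl

erase-++ : ∀ m u w → erase m (u ++ w) ≡ erase m u ++ erase m w
erase-++ m [] w = refl
erase-++ m (x ∷ u) w with does (x ℕ.≟ m)
... | true = erase-++ m u w
... | false = cong (x ∷_) (erase-++ m u w)

erase-free : ∀ P v → WordOver P v → erase (suc P) v ≡ v
erase-free P [] [] = refl
erase-free P (x ∷ v) ((_ , x≤P) ∷ v∈P) rewrite dec-false (x ℕ.≟ suc P) (≤⇒≢suc x≤P) =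
  cong (x ∷_) (erase-free P v v∈P)

erase-head : ∀ m w → erase m (m ∷ w) ≡ erase m w
erase-head m w rewrite dec-true (m ℕ.≟ m) refl = refl

countL-singleton-≢ : ∀ {m x} → x ≢ m → countL m [ x ] ≡ 0
countL-singleton-≢ {m} {x} x≢m rewrite dec-false (x ℕ.≟ m) x≢m = refl

partialSum-singleton-< : ∀ x k → k < x → partialSum [ x ] k ≡ 0
partialSum-singleton-< x zero _ = refl
partialSum-singleton-< x (suc k) 1+k<x =
  cong₂ ℕ._+_ (partialSum-singleton-< x k (ℕₚ.<-trans (ℕₚ.n<1+n k) 1+k<x))
              (countL-singleton-≢ (ℕₚ.>⇒≢ 1+k<x))

partialSum-singleton-≤ : ∀ x k → 1 ≤ x → x ≤ k → partialSum [ x ] k ≡ 1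
partialSum-singleton-≤ x zero 1≤x x≤0 = ⊥-elim (ℕₚ.<⇒≱ 1≤x x≤0)
partialSum-singleton-≤ x (suc k) 1≤x x≤1+k with x ℕ.≟ suc k
... | yes refl = cong₂ ℕ._+_ (partialSum-singleton-< x k ℕₚ.≤-refl) (countL-head x [])
... | no x≢1+k = trans (cong₂ ℕ._+_ (partialSum-singleton-≤ x k 1≤x (≤suc-≢⇒≤ x≤1+k x≢1+k))
                                   (countL-singleton-≢ x≢1+k))
                       (ℕₚ.+-identityʳ 1)

partialSum-++ : ∀ u w k → partialSum (u ++ w) k ≡ partialSum u k ℕ.+ partialSum w k
partialSum-++ u w zero = refl
partialSum-++ u w (suc k) rewrite partialSum-++ u w k | countL-++ (suc k) u w =
  solve 4 (λ a b c d → (a :+ b) :+ (c :+ d) := (a :+ c) :+ (b :+ d)) refl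
    (partialSum u k) (partialSum w k) (countL (suc k) u) (countL (suc k) w)
  where open ℕ-Solver

partialSum-[] : ∀ k → partialSum [] k ≡ 0
partialSum-[] zero = refl
partialSum-[] (suc k) = trans (ℕₚ.+-identityʳ _) (partialSum-[] k)

partialSum-full : ∀ m w → WordOver m w → partialSum w m ≡ length w
partialSum-full m [] [] = partialSum-[] m
partialSum-full m (x ∷ w) ((1≤x , x≤m) ∷ w∈m) =
  trans (partialSum-++ [ x ] w m) (cong₂ ℕ._+_ (partialSum-singleton-≤ x m 1≤x x≤m) (partialSum-full m w w∈m))

countL-erase : ∀ m j w → j ≢ m → countL j (erase m w) ≡ countL j w
countL-erase m j [] _ = refl
countL-erase m j (x ∷ w) j≢m with x ℕ.≟ m
... | yes refl rewrite dec-true (x ℕ.≟ x) refl | dec-false (x ℕ.≟ j) (j≢m ∘ sym) = countL-erase m j w j≢m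
... | no x≢m rewrite dec-false (x ℕ.≟ m) x≢m with does (x ℕ.≟ j)
...   | true = cong suc (countL-erase m j w j≢m)
...   | false = countL-erase m j w j≢m

partialSum-erase : ∀ P w k → k ≤ P → partialSum (erase (suc P) w) k ≡ partialSum w k
partialSum-erase P w zero _ = refl
partialSum-erase P w (suc k) 1+k≤P =
  cong₂ ℕ._+_ (partialSum-erase P w k (ℕₚ.<⇒≤ 1+k≤P)) (countL-erase (suc P) (suc k) w (≤⇒≢suc 1+k≤P))

∈-erase : ∀ m k w → k ≢ m → k ∈ w → k ∈ erase m w
∈-erase m k (x ∷ w) k≢m (here refl) rewrite dec-false (k ℕ.≟ m) k≢m = here refl
∈-erase m k (x ∷ w) k≢m (there k∈w) with does (x ℕ.≟ m)
... | true = ∈-erase m k w k≢m k∈w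
... | false = there (∈-erase m k w k≢m k∈w)

erase-⊆ : ∀ m k w → k ∈ erase m w → k ∈ w
erase-⊆ m k (x ∷ w) k∈ with does (x ℕ.≟ m)
... | true = there (erase-⊆ m k w k∈)
erase-⊆ m k (x ∷ w) (here k≡x) | false = here k≡x
erase-⊆ m k (x ∷ w) (there k∈) | false = there (erase-⊆ m k w k∈)

-- Packed words

countL≡0⇒∉ : ∀ m w → countL m w ≡ 0 → ¬ (m ∈ w)
countL≡0⇒∉ m (x ∷ w) count≡0 (here refl) rewrite dec-true (m ℕ.≟ m) refl with count≡0
... | ()
countL≡0⇒∉ m (x ∷ w) count≡0 (there m∈w) with does (x ℕ.≟ m)
... | true with count≡0
...   | ()
countL≡0⇒∉ m (x ∷ w) count≡0 (there m∈w) | false = countL≡0⇒∉ m w count≡0 m∈w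

countL≡suc⇒∈ : ∀ m w c → countL m w ≡ suc c → m ∈ w
countL≡suc⇒∈ m (x ∷ w) c count≡1+c with x ℕ.≟ m
... | yes refl = here refl
... | no x≢m rewrite dec-false (x ℕ.≟ m) x≢m = there (countL≡suc⇒∈ m w c count≡1+c)

isPacked : ℕ → Word → Bool
isPacked p u = does (all? (_∈? u) (oneTo p))

isPacked-suc-absent : ∀ P u → countL (suc P) u ≡ 0 → isPacked (suc P) u ≡ false
isPacked-suc-absent P u count≡0 = dec-false (all? (_∈? u) (oneTo (suc P))) λ all∈ →
  countL≡0⇒∉ (suc P) u count≡0 (All.head (All.++⁻ʳ (oneTo P) (subst (All (_∈ u)) (oneTo-suc P) all∈)))

isPacked-suc-present : ∀ P u c → countL (suc P) u ≡ suc c → isPacked (suc P) u ≡ isPacked P (erase (suc P) u)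
isPacked-suc-present P u c count≡1+c = does-⇔ (mk⇔ to from)
  (all? (_∈? u) (oneTo (suc P))) (all? (_∈? erase (suc P) u) (oneTo P))
  where
  to : All (_∈ u) (oneTo (suc P)) → All (_∈ erase (suc P) u) (oneTo P)
  to all∈ = All.zipWith (λ ((_ , k≤P) , k∈u) → ∈-erase (suc P) _ u (≤⇒≢suc k≤P) k∈u)
              (letters-oneTo P , All.++⁻ˡ (oneTo P) (subst (All (_∈ u)) (oneTo-suc P) all∈))
  from : All (_∈ erase (suc P) u) (oneTo P) → All (_∈ u) (oneTo (suc P))
  from all∈ = subst (All (_∈ u)) (sym (oneTo-suc P))
    (All.++⁺ (All.map (erase-⊆ (suc P) _ u) all∈) (countL≡suc⇒∈ (suc P) u c count≡1+c ∷ []))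

module _ (P : ℕ) (x : ℚ) where

  weight : (Word → ℚ) → Word → ℚ
  weight Ψ w = x ^ countL (suc P) w * Ψ (erase (suc P) w)

  weight-free : ∀ Ψ v → WordOver P v → weight Ψ v ≡ Ψ v
  weight-free Ψ v v∈P rewrite countL-free P v v∈P | erase-free P v v∈P = ℚ.*-identityˡ (Ψ v)

  weight-++ : ∀ Ψ v w → weight Ψ (v ++ w) ≡ x ^ countL (suc P) v * weight (λ u → Ψ (erase (suc P) v ++ u)) w
  weight-++ Ψ v w rewrite countL-++ (suc P) v w | erase-++ (suc P) v w
                        | ^-distribˡ-+-* x (countL (suc P) v) (countL (suc P) w) =
    ℚ.*-assoc (x ^ countL (suc P) v) (x ^ countL (suc P) w) _

  weight-separator : ∀ Ψ v y → WordOver P v →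
    weight Ψ (v ++ suc P ∷ y) ≡ x * weight (λ u → Ψ (v ++ u)) y
  weight-separator Ψ v y v∈P rewrite weight-++ Ψ v (suc P ∷ y) | countL-free P v v∈P | erase-free P v v∈P
                                   | countL-head (suc P) y | erase-head (suc P) y =
    trans (ℚ.*-identityˡ _) (ℚ.*-assoc x _ _)

  ∑Join-weight : ∀ U Us Ψ → ∑Join P (U ∷ Us) (weight Ψ) ≡ x ^ length Us * ∑Concat P (U ∷ Us) Ψ
  ∑Join-weight U [] Ψ = begin
    ∑Tree P U (weight Ψ)               ≡⟨ ∑Tree-cong-on P U (λ v v∈P _ → trans (weight-free Ψ v v∈P)
                                                                               (cong Ψ (sym (List.++-identityʳ v)))) ⟩
    ∑Tree P U (λ v → Ψ (v ++ []))      ≡⟨ ℚ.*-identityˡ _ ⟨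
    1ℚ * ∑Tree P U (λ v → Ψ (v ++ [])) ∎
    where open ≡-Reasoning
  ∑Join-weight U (U′ ∷ Us) Ψ = begin
    ∑Tree P U (λ v → ∑Join P (U′ ∷ Us) (λ y → weight Ψ (v ++ suc P ∷ y)))
      ≡⟨ ∑Tree-cong-on P U (λ v v∈P _ → per-first-block v v∈P) ⟩
    ∑Tree P U (λ v → (x * x ^ length Us) * ∑Concat P (U′ ∷ Us) (λ w → Ψ (v ++ w)))
      ≡⟨ ∑Tree-*ˡ P U (x * x ^ length Us) _ ⟩
    (x * x ^ length Us) * ∑Concat P (U ∷ U′ ∷ Us) Ψ ∎
    where
    open ≡-Reasoning
    per-first-block : ∀ v → WordOver P v →
      ∑Join P (U′ ∷ Us) (λ y → weight Ψ (v ++ suc P ∷ y)) ≡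
      (x * x ^ length Us) * ∑Concat P (U′ ∷ Us) (λ w → Ψ (v ++ w))
    per-first-block v v∈P = begin
      ∑Join P (U′ ∷ Us) (λ y → weight Ψ (v ++ suc P ∷ y))
        ≡⟨ ∑Join-cong P (U′ ∷ Us) (λ y → weight-separator Ψ v y v∈P) ⟩
      ∑Join P (U′ ∷ Us) (λ y → x * weight (λ u → Ψ (v ++ u)) y)
        ≡⟨ ∑Join-*ˡ P (U′ ∷ Us) x _ ⟩
      x * ∑Join P (U′ ∷ Us) (weight (λ u → Ψ (v ++ u)))
        ≡⟨ cong (x *_) (∑Join-weight U′ Us (λ u → Ψ (v ++ u))) ⟩
      x * (x ^ length Us * ∑Concat P (U′ ∷ Us) (λ w → Ψ (v ++ w)))
        ≡⟨ ℚ.*-assoc x _ _ ⟨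
      (x * x ^ length Us) * ∑Concat P (U′ ∷ Us) (λ w → Ψ (v ++ w)) ∎

-- Expanding roots of a forest

rootExpansions : PTree → List (List PTree × ℕ)
rootExpansions leaf = [ [ leaf ] , 0 ]
rootExpansions (node T₀ T₁ Ts) = ([ node T₀ T₁ Ts ] , 0) ∷ [ T₀ ∷ T₁ ∷ Ts , suc (length Ts) ]

expansions : List PTree → List (List PTree × ℕ)
expansions [] = [ [] , 0 ]
expansions (T ∷ Fs) =
  concatMap (λ (A , k) → map (λ (F , i) → A ++ F , k ℕ.+ i) (expansions Fs)) (rootExpansions T)

regionsL-++ : ∀ Fs Gs → regionsL (Fs ++ Gs) ≡ regionsL Fs ℕ.+ regionsL Gs
regionsL-++ [] Gs = refl
regionsL-++ (T ∷ Fs) Gs = trans (cong (regions T ℕ.+_) (regionsL-++ Fs Gs)) (sym (ℕₚ.+-assoc (regions T) _ _))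

rootExpansions-regions : ∀ T → All (λ (A , k) → regionsL A ℕ.+ k ≡ regions T) (rootExpansions T)
rootExpansions-regions leaf = refl ∷ []
rootExpansions-regions T@(node T₀ T₁ Ts) =
  trans (ℕₚ.+-identityʳ _) (ℕₚ.+-identityʳ (regions T)) ∷
  ℕₚ.+-comm (regionsL (T₀ ∷ T₁ ∷ Ts)) _ ∷ []

expansions-regions : ∀ Fs → All (λ (F , i) → regionsL F ℕ.+ i ≡ regionsL Fs) (expansions Fs)
expansions-regions [] = refl ∷ []
expansions-regions (T ∷ Fs) = All.concat⁺ (All.map⁺ (All.map (λ {(A , k)} A-inv →
  All.map⁺ (All.map (λ {(F , i)} F-inv → combine A k F i A-inv F-inv) (expansions-regions Fs)))
  (rootExpansions-regions T)))
  where
  combine : ∀ A k F i → regionsL A ℕ.+ k ≡ regions T → regionsL F ℕ.+ i ≡ regionsL Fs →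
    regionsL (A ++ F) ℕ.+ (k ℕ.+ i) ≡ regions T ℕ.+ regionsL Fs
  combine A k F i A-inv F-inv rewrite regionsL-++ A F | sym A-inv | sym F-inv =
    solve 4 (λ a b c d → (a :+ c) :+ (b :+ d) := (a :+ b) :+ (c :+ d)) refl (regionsL A) k (regionsL F) i
    where open ℕ-Solver

∑Tree-suc-node-weight : ∀ P x T₀ T₁ Ts Φ →
  ∑Tree (suc P) (node T₀ T₁ Ts) (weight P x Φ) ≡
  1ℚ * ∑Concat P [ node T₀ T₁ Ts ] Φ + x ^ suc (length Ts) * ∑Concat P (T₀ ∷ T₁ ∷ Ts) Φ
∑Tree-suc-node-weight P x T₀ T₁ Ts Φ = begin
  ∑Tree (suc P) T (weight P x Φ)
    ≡⟨ ∑Tree-suc-node P T₀ T₁ Ts (weight P x Φ) ⟩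
  ∑Tree P T (weight P x Φ) + ∑Join P (T₀ ∷ T₁ ∷ Ts) (weight P x Φ)
    ≡⟨ cong₂ _+_ unchanged (∑Join-weight P x T₀ (T₁ ∷ Ts) Φ) ⟩
  1ℚ * ∑Concat P [ T ] Φ + x ^ suc (length Ts) * ∑Concat P (T₀ ∷ T₁ ∷ Ts) Φ ∎
  where
  open ≡-Reasoning
  T = node T₀ T₁ Ts
  unchanged : ∑Tree P T (weight P x Φ) ≡ 1ℚ * ∑Concat P [ T ] Φ
  unchanged = trans (∑Tree-cong-on P T (λ v v∈P _ → trans (weight-free P x Φ v v∈P)
                                                          (cong Φ (sym (List.++-identityʳ v)))))
                    (sym (ℚ.*-identityˡ _))

∑Tree-suc-alphabet : ∀ P x T Φ →
  ∑Tree (suc P) T (weight P x Φ) ≡ ∑ (λ (A , k) → x ^ k * ∑Concat P A Φ) (rootExpansions T)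
∑Tree-suc-alphabet P x leaf Φ =
  trans (∑Tree-leaf (suc P) (weight P x Φ))
        (sym (trans (∑-[ _ ] ([ leaf ] , 0)) (cong (1ℚ *_) (∑Tree-leaf P (λ v → Φ (v ++ []))))))
∑Tree-suc-alphabet P x (node T₀ T₁ Ts) Φ =
  trans (∑Tree-suc-node-weight P x T₀ T₁ Ts Φ)
        (sym (trans (∑-∷ f _ _) (cong (f ([ node T₀ T₁ Ts ] , 0) +_) (∑-[ f ] _))))
  where
  f : List PTree × ℕ → ℚ
  f (A , k) = x ^ k * ∑Concat P A Φ

∑Concat-prefix : ∀ P x A k Ψ (L : List (List PTree × ℕ)) →
  x ^ k * ∑Concat P A (λ v → ∑ (λ (F , i) → x ^ i * ∑Concat P F (λ w → Ψ (v ++ w))) L) ≡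
  ∑ (λ (F , i) → x ^ (k ℕ.+ i) * ∑Concat P (A ++ F) Ψ) L
∑Concat-prefix P x A k Ψ L = begin
  x ^ k * ∑Concat P A (λ v → ∑ (λ (F , i) → x ^ i * ∑Concat P F (λ w → Ψ (v ++ w))) L)
    ≡⟨ cong (x ^ k *_) (∑Concat-∑ P A _ L) ⟩
  x ^ k * ∑ (λ (F , i) → ∑Concat P A (λ v → x ^ i * ∑Concat P F (λ w → Ψ (v ++ w)))) L
    ≡⟨ cong (x ^ k *_) (∑-cong term L) ⟩
  x ^ k * ∑ (λ (F , i) → x ^ i * ∑Concat P (A ++ F) Ψ) L
    ≡⟨ ∑-*ˡ (x ^ k) _ L ⟨
  ∑ (λ (F , i) → x ^ k * (x ^ i * ∑Concat P (A ++ F) Ψ)) L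
    ≡⟨ ∑-cong (λ (F , i) → trans (sym (ℚ.*-assoc (x ^ k) (x ^ i) _))
                                 (cong (_* ∑Concat P (A ++ F) Ψ) (sym (^-distribˡ-+-* x k i)))) L ⟩
  ∑ (λ (F , i) → x ^ (k ℕ.+ i) * ∑Concat P (A ++ F) Ψ) L ∎
  where
  open ≡-Reasoning
  term : ∀ ((F , i) : List PTree × ℕ) →
    ∑Concat P A (λ v → x ^ i * ∑Concat P F (λ w → Ψ (v ++ w))) ≡ x ^ i * ∑Concat P (A ++ F) Ψ
  term (F , i) = trans (∑Concat-*ˡ P A (x ^ i) _) (cong (x ^ i *_) (sym (∑Concat-++ P A F Ψ)))

∑Concat-suc-alphabet : ∀ P x Fs Ψ →
  ∑Concat (suc P) Fs (weight P x Ψ) ≡ ∑ (λ (F , i) → x ^ i * ∑Concat P F Ψ) (expansions Fs)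
∑Concat-suc-alphabet P x [] Ψ = sym (∑-[ _ ] ([] , 0))
∑Concat-suc-alphabet P x (T ∷ Fs) Ψ = begin
  ∑Tree (suc P) T (λ v → ∑Concat (suc P) Fs (λ w → weight P x Ψ (v ++ w)))
    ≡⟨ ∑Tree-cong (suc P) T split-first ⟩
  ∑Tree (suc P) T (weight P x Φ)
    ≡⟨ ∑Tree-suc-alphabet P x T Φ ⟩
  ∑ (λ (A , k) → x ^ k * ∑Concat P A Φ) (rootExpansions T)
    ≡⟨ ∑-cong (λ (A , k) → ∑Concat-prefix P x A k Ψ (expansions Fs)) (rootExpansions T) ⟩
  ∑ (λ (A , k) → ∑ (λ (F , i) → x ^ (k ℕ.+ i) * ∑Concat P (A ++ F) Ψ) (expansions Fs)) (rootExpansions T)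
    ≡⟨ ∑-cong (λ (A , k) → ∑-map _ _ (expansions Fs)) (rootExpansions T) ⟨
  ∑ (λ (A , k) → ∑ f (map (λ (F , i) → A ++ F , k ℕ.+ i) (expansions Fs))) (rootExpansions T)
    ≡⟨ ∑-concatMap f _ (rootExpansions T) ⟨
  ∑ f (expansions (T ∷ Fs)) ∎
  where
  open ≡-Reasoning
  f : List PTree × ℕ → ℚ
  f (F , i) = x ^ i * ∑Concat P F Ψ
  Φ : Word → ℚ
  Φ u = ∑ (λ (F , i) → x ^ i * ∑Concat P F (λ w → Ψ (u ++ w))) (expansions Fs)
  split-first : ∀ v → ∑Concat (suc P) Fs (λ w → weight P x Ψ (v ++ w)) ≡ weight P x Φ v
  split-first v = begin
    ∑Concat (suc P) Fs (λ w → weight P x Ψ (v ++ w))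
      ≡⟨ ∑Concat-cong (suc P) Fs (weight-++ P x Ψ v) ⟩
    ∑Concat (suc P) Fs (λ w → x ^ countL (suc P) v * weight P x (λ u → Ψ (erase (suc P) v ++ u)) w)
      ≡⟨ ∑Concat-*ˡ (suc P) Fs (x ^ countL (suc P) v) _ ⟩
    x ^ countL (suc P) v * ∑Concat (suc P) Fs (weight P x (λ u → Ψ (erase (suc P) v ++ u)))
      ≡⟨ cong (x ^ countL (suc P) v *_) (∑Concat-suc-alphabet P x Fs (λ u → Ψ (erase (suc P) v ++ u))) ⟩
    weight P x Φ v ∎

-- The (q, t)-specialisation

module Specialisation (q t : ℚ) where

  denom : ℕ → ℚ
  denom N = 1ℚ - q ^ N

  factor : Word → ℕ → ℚ
  factor w k = (q ^ partialSum w k - t ^ countL k w) ÷₀ denom (partialSum w k)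

  factors : ℕ → Word → ℚ
  factors P w = prodL (map (factor w) (oneTo P))

  packedWeight : ℕ → Word → ℚ
  packedWeight P w = [ isPacked P w ]· factors P w

  Z : ℕ → List PTree → ℚ
  Z P Fs = ∑Concat P Fs (packedWeight P)

  -- coef N i is (q^N - t^i)/(1 - q^N) for i > 0 and 0 for i = 0 (see coef-suc, coef-zero); it is
  -- written through the powers 1^i, t^i and 0^i so that each summand is a `weight`.
  coef : ℕ → ℕ → ℚ
  coef N i = (q ^ N * denom N ⁻¹) * 1ℚ ^ i + (- denom N ⁻¹) * t ^ i + 0ℚ ^ i

  factors-erase : ∀ P w → factors P (erase (suc P) w) ≡ factors P w
  factors-erase P w = cong prodL (List.map-cong-local (All.map same-factor (letters-oneTo P)))
    where
    same-factor : ∀ {k} → Letter P k → factor (erase (suc P) w) k ≡ factor w k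
    same-factor (_ , k≤P) = cong₂ (λ s c → (q ^ s - t ^ c) ÷₀ denom s)
      (partialSum-erase P w _ k≤P) (countL-erase (suc P) _ w (≤⇒≢suc k≤P))

  factors-suc : ∀ P w → WordOver (suc P) w →
    factors (suc P) w ≡ factors P w * ((q ^ length w - t ^ countL (suc P) w) ÷₀ denom (length w))
  factors-suc P w w∈P = begin
    prodL (map (factor w) (oneTo (suc P)))
      ≡⟨ cong (prodL ∘ map (factor w)) (oneTo-suc P) ⟩
    prodL (map (factor w) (oneTo P ++ [ suc P ]))
      ≡⟨ cong prodL (List.map-++ (factor w) (oneTo P) [ suc P ]) ⟩
    prodL (map (factor w) (oneTo P) ++ [ factor w (suc P) ])
      ≡⟨ prodL-++ (map (factor w) (oneTo P)) [ factor w (suc P) ] ⟩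
    factors P w * (factor w (suc P) * 1ℚ)
      ≡⟨ cong (λ z → factors P w * z) (ℚ.*-identityʳ _) ⟩
    factors P w * factor w (suc P)
      ≡⟨ cong (λ s → factors P w * ((q ^ s - t ^ countL (suc P) w) ÷₀ denom s))
              (partialSum-full (suc P) w w∈P) ⟩
    factors P w * ((q ^ length w - t ^ countL (suc P) w) ÷₀ denom (length w)) ∎
    where open ≡-Reasoning

  coef-zero : ∀ N → denom N ≢ 0ℚ → coef N 0 ≡ 0ℚ
  coef-zero N D≢0 = begin
    (Q * i) * 1ℚ + (- i) * 1ℚ + 1ℚ
      ≡⟨ solve 2 (λ Q i → (Q :* i) :* con 1ℚ :+ (:- i) :* con 1ℚ :+ con 1ℚ := Q :* i :- i :+ con 1ℚ)
               refl Q i ⟩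
    Q * i - i + 1ℚ
      ≡⟨ cong (Q * i - i +_) (*-⁻¹-inverse (denom N) D≢0) ⟨
    Q * i - i + (1ℚ - Q) * i
      ≡⟨ solve 2 (λ Q i → Q :* i :- i :+ (con 1ℚ :- Q) :* i := con 0ℚ) refl Q i ⟩
    0ℚ ∎
    where
    open ≡-Reasoning
    open ℚ-Solver
    Q = q ^ N
    i = denom N ⁻¹

  coef-suc : ∀ N c → coef N (suc c) ≡ (q ^ N - t ^ suc c) ÷₀ denom N
  coef-suc N c = begin
    (Q * i) * 1ℚ ^ suc c + (- i) * τ + 0ℚ ^ suc c
      ≡⟨ cong₂ (λ o z → (Q * i) * o + (- i) * τ + z) (^-zeroˡ (suc c)) (0^suc≡0 c) ⟩
    (Q * i) * 1ℚ + (- i) * τ + 0ℚ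
      ≡⟨ solve 3 (λ Q i τ → (Q :* i) :* con 1ℚ :+ (:- i) :* τ :+ con 0ℚ := (Q :- τ) :* i) refl Q i τ ⟩
    (Q - τ) * i
      ≡⟨ ÷₀≡*⁻¹ (Q - τ) (denom N) ⟨
    (Q - τ) ÷₀ denom N ∎
    where
    open ≡-Reasoning
    open ℚ-Solver
    Q = q ^ N
    τ = t ^ suc c
    i = denom N ⁻¹

  packedWeight-suc : ∀ P w N → WordOver (suc P) w → length w ≡ N → denom N ≢ 0ℚ →
    packedWeight (suc P) w ≡ coef N (countL (suc P) w) * packedWeight P (erase (suc P) w)
  packedWeight-suc P w N w∈P refl D≢0 = by-count (countL (suc P) w) refl
    where
    open ≡-Reasoning
    by-count : ∀ c → countL (suc P) w ≡ c →
      packedWeight (suc P) w ≡ coef N (countL (suc P) w) * packedWeight P (erase (suc P) w)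
    by-count zero count≡0 = begin
      [ isPacked (suc P) w ]· factors (suc P) w
        ≡⟨ cong ([_]· factors (suc P) w) (isPacked-suc-absent P w count≡0) ⟩
      0ℚ
        ≡⟨ ℚ.*-zeroˡ (packedWeight P (erase (suc P) w)) ⟨
      0ℚ * packedWeight P (erase (suc P) w)
        ≡⟨ cong (_* packedWeight P (erase (suc P) w))
                (trans (sym (coef-zero N D≢0)) (cong (coef N) (sym count≡0))) ⟩
      coef N (countL (suc P) w) * packedWeight P (erase (suc P) w) ∎
    by-count (suc c) count≡1+c = begin
      [ isPacked (suc P) w ]· factors (suc P) w
        ≡⟨ cong₂ [_]·_ (isPacked-suc-present P w c count≡1+c) (factors-suc P w w∈P) ⟩
      [ isPacked P (erase (suc P) w) ]· (factors P w * fac)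
        ≡⟨ cong (λ z → [ isPacked P (erase (suc P) w) ]· (z * fac)) (sym (factors-erase P w)) ⟩
      [ isPacked P (erase (suc P) w) ]· (factors P (erase (suc P) w) * fac)
        ≡⟨ cong ([ isPacked P (erase (suc P) w) ]·_) (ℚ.*-comm _ fac) ⟩
      [ isPacked P (erase (suc P) w) ]· (fac * factors P (erase (suc P) w))
        ≡⟨ []·-*-comm (isPacked P (erase (suc P) w)) fac _ ⟩
      fac * packedWeight P (erase (suc P) w)
        ≡⟨ cong (λ c′ → ((q ^ N - t ^ c′) ÷₀ denom N) * packedWeight P (erase (suc P) w)) count≡1+c ⟩
      ((q ^ N - t ^ suc c) ÷₀ denom N) * packedWeight P (erase (suc P) w)
        ≡⟨ cong (_* packedWeight P (erase (suc P) w)) (trans (sym (coef-suc N c)) (cong (coef N) (sym count≡1+c))) ⟩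
      coef N (countL (suc P) w) * packedWeight P (erase (suc P) w) ∎
      where fac = (q ^ N - t ^ countL (suc P) w) ÷₀ denom N

  coef-distrib : ∀ N c y →
    coef N c * y ≡ (q ^ N * denom N ⁻¹) * (1ℚ ^ c * y) + (- denom N ⁻¹) * (t ^ c * y) + 0ℚ ^ c * y
  coef-distrib N c y =
    solve 6 (λ a b o τ z y → (a :* o :+ b :* τ :+ z) :* y := a :* (o :* y) :+ b :* (τ :* y) :+ z :* y) refl
      (q ^ N * denom N ⁻¹) (- denom N ⁻¹) (1ℚ ^ c) (t ^ c) (0ℚ ^ c) y
    where open ℚ-Solver

  Z-suc : ∀ P Fs → denom (regionsL Fs) ≢ 0ℚ →
    Z (suc P) Fs ≡ ∑ (λ (F , i) → coef (regionsL Fs) i * Z P F) (expansions Fs)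
  Z-suc P Fs D≢0 = begin
    ∑Concat (suc P) Fs (packedWeight (suc P))
      ≡⟨ ∑Concat-cong-on (suc P) Fs decompose ⟩
    ∑Concat (suc P) Fs (λ w → a * weight P 1ℚ K w + b * weight P t K w + weight P 0ℚ K w)
      ≡⟨ ∑Concat-lincomb (suc P) Fs a b (weight P 1ℚ K) (weight P t K) (weight P 0ℚ K) ⟩
    a * ∑Concat (suc P) Fs (weight P 1ℚ K) + b * ∑Concat (suc P) Fs (weight P t K)
      + ∑Concat (suc P) Fs (weight P 0ℚ K)
      ≡⟨ cong₂ _+_ (cong₂ (λ x y → a * x + b * y) (∑Concat-suc-alphabet P 1ℚ Fs K)
                                                   (∑Concat-suc-alphabet P t Fs K))
                   (∑Concat-suc-alphabet P 0ℚ Fs K) ⟩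
    a * S 1ℚ + b * S t + S 0ℚ
      ≡⟨ ∑-lincomb a b (term 1ℚ) (term t) (term 0ℚ) (expansions Fs) ⟨
    ∑ (λ (F , i) → a * (1ℚ ^ i * Z P F) + b * (t ^ i * Z P F) + 0ℚ ^ i * Z P F) (expansions Fs)
      ≡⟨ ∑-cong (λ (F , i) → sym (coef-distrib N i (Z P F))) (expansions Fs) ⟩
    ∑ (λ (F , i) → coef N i * Z P F) (expansions Fs) ∎
    where
    open ≡-Reasoning
    N = regionsL Fs
    a = q ^ N * denom N ⁻¹
    b = - denom N ⁻¹
    K = packedWeight P
    term : ℚ → List PTree × ℕ → ℚ
    term x (F , i) = x ^ i * Z P F
    S : ℚ → ℚ
    S x = ∑ (term x) (expansions Fs)
    decompose : ∀ w → WordOver (suc P) w → length w ≡ N →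
      packedWeight (suc P) w ≡ a * weight P 1ℚ K w + b * weight P t K w + weight P 0ℚ K w
    decompose w w∈P |w|≡N =
      trans (packedWeight-suc P w N w∈P |w|≡N D≢0) (coef-distrib N (countL (suc P) w) _)

  DenomsNonZero : ℕ → Set
  DenomsNonZero n = ∀ k → 1 ≤ k → k ≤ n → denom k ≢ 0ℚ

  DenomsNonZero-mono : ∀ {m n} → m ≤ n → DenomsNonZero n → DenomsNonZero m
  DenomsNonZero-mono m≤n D≢0 k 1≤k k≤m = D≢0 k 1≤k (ℕₚ.≤-trans k≤m m≤n)

  nodeProdL-++ : ∀ Fs Gs → nodeProdL q t (Fs ++ Gs) ≡ nodeProdL q t Fs * nodeProdL q t Gs
  nodeProdL-++ [] Gs = sym (ℚ.*-identityˡ _)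
  nodeProdL-++ (T ∷ Fs) Gs =
    trans (cong (nodeProd q t T *_) (nodeProdL-++ Fs Gs)) (sym (ℚ.*-assoc (nodeProd q t T) _ _))

  rootPoly : ℚ → PTree → ℚ
  rootPoly x leaf = 1ℚ
  rootPoly x (node T₀ T₁ Ts) =
    nodeProd q t (node T₀ T₁ Ts) + x ^ suc (length Ts) * nodeProdL q t (T₀ ∷ T₁ ∷ Ts)

  forestPoly : ℚ → List PTree → ℚ
  forestPoly x [] = 1ℚ
  forestPoly x (T ∷ Fs) = rootPoly x T * forestPoly x Fs

  ∑-rootExpansions : ∀ x T → ∑ (λ (A , k) → x ^ k * nodeProdL q t A) (rootExpansions T) ≡ rootPoly x T
  ∑-rootExpansions x leaf = trans (∑-[ _ ] ([ leaf ] , 0)) (trans (ℚ.*-identityˡ _) (ℚ.*-identityˡ _))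
  ∑-rootExpansions x (node T₀ T₁ Ts) =
    trans (∑-∷ f ([ T ] , 0) [ T₀ ∷ T₁ ∷ Ts , suc (length Ts) ])
          (cong₂ _+_ (trans (ℚ.*-identityˡ _) (ℚ.*-identityʳ (nodeProd q t T)))
                     (∑-[ f ] (T₀ ∷ T₁ ∷ Ts , suc (length Ts))))
    where
    T = node T₀ T₁ Ts
    f : List PTree × ℕ → ℚ
    f (A , k) = x ^ k * nodeProdL q t A

  ∑-expansions : ∀ x Fs → ∑ (λ (F , i) → x ^ i * nodeProdL q t F) (expansions Fs) ≡ forestPoly x Fs
  ∑-expansions x [] = trans (∑-[ _ ] ([] , 0)) (ℚ.*-identityˡ 1ℚ)
  ∑-expansions x (T ∷ Fs) = begin
    ∑ f (expansions (T ∷ Fs))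
      ≡⟨ ∑-concatMap f _ (rootExpansions T) ⟩
    ∑ (λ (A , k) → ∑ f (map (λ (F , i) → A ++ F , k ℕ.+ i) (expansions Fs))) (rootExpansions T)
      ≡⟨ ∑-cong (λ (A , k) → trans (∑-map f _ (expansions Fs)) (prefixed A k)) (rootExpansions T) ⟩
    ∑ (λ (A , k) → f (A , k) * forestPoly x Fs) (rootExpansions T)
      ≡⟨ ∑-*ʳ (forestPoly x Fs) f (rootExpansions T) ⟩
    ∑ f (rootExpansions T) * forestPoly x Fs
      ≡⟨ cong (_* forestPoly x Fs) (∑-rootExpansions x T) ⟩
    rootPoly x T * forestPoly x Fs ∎
    where
    open ≡-Reasoning
    f : List PTree × ℕ → ℚ
    f (A , k) = x ^ k * nodeProdL q t A
    prefixed : ∀ A k → ∑ (λ (F , i) → f (A ++ F , k ℕ.+ i)) (expansions Fs) ≡ f (A , k) * forestPoly x Fs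
    prefixed A k = begin
      ∑ (λ (F , i) → f (A ++ F , k ℕ.+ i)) (expansions Fs)
        ≡⟨ ∑-cong (λ (F , i) → split F i) (expansions Fs) ⟩
      ∑ (λ (F , i) → f (A , k) * f (F , i)) (expansions Fs)
        ≡⟨ ∑-*ˡ (f (A , k)) f (expansions Fs) ⟩
      f (A , k) * ∑ f (expansions Fs)
        ≡⟨ cong (f (A , k) *_) (∑-expansions x Fs) ⟩
      f (A , k) * forestPoly x Fs ∎
      where
      split : ∀ F i → f (A ++ F , k ℕ.+ i) ≡ f (A , k) * f (F , i)
      split F i rewrite ^-distribˡ-+-* x k i | nodeProdL-++ A F =
        solve 4 (λ a b c d → (a :* b) :* (c :* d) := (a :* c) :* (b :* d)) refl
          (x ^ k) (x ^ i) (nodeProdL q t A) (nodeProdL q t F)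
        where open ℚ-Solver

  forestPoly-zero : ∀ Fs → forestPoly 0ℚ Fs ≡ nodeProdL q t Fs
  forestPoly-zero [] = refl
  forestPoly-zero (T ∷ Fs) = cong₂ _*_ (rootPoly-zero T) (forestPoly-zero Fs)
    where
    rootPoly-zero : ∀ T → rootPoly 0ℚ T ≡ nodeProd q t T
    rootPoly-zero leaf = refl
    rootPoly-zero (node T₀ T₁ Ts) = trans
      (cong (nodeProd q t (node T₀ T₁ Ts) +_)
            (trans (cong (_* Y) (0^suc≡0 (length Ts))) (ℚ.*-zeroˡ Y)))
      (ℚ.+-identityʳ _)
      where Y = nodeProdL q t (T₀ ∷ T₁ ∷ Ts)

  rootPoly-scaling : ∀ T → DenomsNonZero (regions T) → q ^ regions T * rootPoly 1ℚ T ≡ rootPoly t T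
  rootPoly-scaling leaf _ = ℚ.*-identityˡ 1ℚ
  rootPoly-scaling (node T₀ T₁ Ts) D≢0 = begin
    Q * ((Q - τ) ÷₀ denom r * Y + 1ℚ ^ suc (length Ts) * Y)
      ≡⟨ cong₂ (λ z o → Q * (z * Y + o * Y)) (÷₀≡*⁻¹ (Q - τ) (denom r)) (^-zeroˡ (suc (length Ts))) ⟩
    Q * ((Q - τ) * i * Y + 1ℚ * Y)
      ≡⟨ solve 4 (λ Q τ i Y → Q :* ((Q :- τ) :* i :* Y :+ con 1ℚ :* Y)
                    := ((Q :- τ) :* i :* Y :+ τ :* Y) :+ (Q :- τ) :* Y :* ((Q :- con 1ℚ) :* i :+ con 1ℚ))
               refl Q τ i Y ⟩
    ((Q - τ) * i * Y + τ * Y) + (Q - τ) * Y * ((Q - 1ℚ) * i + 1ℚ)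
      ≡⟨ cong (λ z → ((Q - τ) * i * Y + τ * Y) + (Q - τ) * Y * ((Q - 1ℚ) * i + z))
              (*-⁻¹-inverse (denom r) (D≢0 r (s≤s z≤n) ℕₚ.≤-refl)) ⟨
    ((Q - τ) * i * Y + τ * Y) + (Q - τ) * Y * ((Q - 1ℚ) * i + (1ℚ - Q) * i)
      ≡⟨ solve 4 (λ Q τ i Y → ((Q :- τ) :* i :* Y :+ τ :* Y)
                                :+ (Q :- τ) :* Y :* ((Q :- con 1ℚ) :* i :+ (con 1ℚ :- Q) :* i)
                    := (Q :- τ) :* i :* Y :+ τ :* Y) refl Q τ i Y ⟩
    (Q - τ) * i * Y + τ * Y
      ≡⟨ cong (λ z → z * Y + τ * Y) (÷₀≡*⁻¹ (Q - τ) (denom r)) ⟨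
    (Q - τ) ÷₀ denom r * Y + τ * Y ∎
    where
    open ≡-Reasoning
    open ℚ-Solver
    r = regions (node T₀ T₁ Ts)
    Q = q ^ r
    τ = t ^ suc (length Ts)
    i = denom r ⁻¹
    Y = nodeProdL q t (T₀ ∷ T₁ ∷ Ts)

  forestPoly-scaling : ∀ Fs → DenomsNonZero (regionsL Fs) → q ^ regionsL Fs * forestPoly 1ℚ Fs ≡ forestPoly t Fs
  forestPoly-scaling [] _ = ℚ.*-identityˡ 1ℚ
  forestPoly-scaling (T ∷ Fs) D≢0 = begin
    q ^ (regions T ℕ.+ regionsL Fs) * (rootPoly 1ℚ T * forestPoly 1ℚ Fs)
      ≡⟨ cong (_* (rootPoly 1ℚ T * forestPoly 1ℚ Fs)) (^-distribˡ-+-* q (regions T) (regionsL Fs)) ⟩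
    (q ^ regions T * q ^ regionsL Fs) * (rootPoly 1ℚ T * forestPoly 1ℚ Fs)
      ≡⟨ solve 4 (λ a b c d → (a :* b) :* (c :* d) := (a :* c) :* (b :* d)) refl
           (q ^ regions T) (q ^ regionsL Fs) (rootPoly 1ℚ T) (forestPoly 1ℚ Fs) ⟩
    (q ^ regions T * rootPoly 1ℚ T) * (q ^ regionsL Fs * forestPoly 1ℚ Fs)
      ≡⟨ cong₂ _*_ (rootPoly-scaling T (DenomsNonZero-mono (ℕₚ.m≤m+n _ (regionsL Fs)) D≢0))
                   (forestPoly-scaling Fs (DenomsNonZero-mono (ℕₚ.m≤n+m _ (regions T)) D≢0)) ⟩
    rootPoly t T * forestPoly t Fs ∎
    where
    open ≡-Reasoning
    open ℚ-Solver

  ∑-coef-nodeProd : ∀ Fs → DenomsNonZero (regionsL Fs) →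
    ∑ (λ (F , i) → coef (regionsL Fs) i * nodeProdL q t F) (expansions Fs) ≡ nodeProdL q t Fs
  ∑-coef-nodeProd Fs D≢0 = begin
    ∑ (λ (F , i) → coef N i * nodeProdL q t F) (expansions Fs)
      ≡⟨ ∑-cong (λ (F , i) → coef-distrib N i (nodeProdL q t F)) (expansions Fs) ⟩
    ∑ (λ (F , i) → a * term 1ℚ (F , i) + b * term t (F , i) + term 0ℚ (F , i)) (expansions Fs)
      ≡⟨ ∑-lincomb a b (term 1ℚ) (term t) (term 0ℚ) (expansions Fs) ⟩
    a * ∑ (term 1ℚ) (expansions Fs) + b * ∑ (term t) (expansions Fs) + ∑ (term 0ℚ) (expansions Fs)
      ≡⟨ cong₂ _+_ (cong₂ (λ x y → a * x + b * y) (∑-expansions 1ℚ Fs) (∑-expansions t Fs))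
                   (trans (∑-expansions 0ℚ Fs) (forestPoly-zero Fs)) ⟩
    (Q * i) * forestPoly 1ℚ Fs + (- i) * forestPoly t Fs + nodeProdL q t Fs
      ≡⟨ cong (_+ nodeProdL q t Fs) (solve 4 (λ Q i x y → (Q :* i) :* x :+ (:- i) :* y := i :* (Q :* x) :- i :* y)
                                               refl Q i (forestPoly 1ℚ Fs) (forestPoly t Fs)) ⟩
    i * (Q * forestPoly 1ℚ Fs) - i * forestPoly t Fs + nodeProdL q t Fs
      ≡⟨ cong (λ z → i * z - i * forestPoly t Fs + nodeProdL q t Fs) (forestPoly-scaling Fs D≢0) ⟩
    i * forestPoly t Fs - i * forestPoly t Fs + nodeProdL q t Fs
      ≡⟨ solve 2 (λ y z → y :- y :+ z := z) refl (i * forestPoly t Fs) (nodeProdL q t Fs) ⟩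
    nodeProdL q t Fs ∎
    where
    open ≡-Reasoning
    open ℚ-Solver
    N = regionsL Fs
    Q = q ^ N
    i = denom N ⁻¹
    a = Q * i
    b = - i
    term : ℚ → List PTree × ℕ → ℚ
    term x (F , i) = x ^ i * nodeProdL q t F

  Z-leaves : ∀ Fs → All (_≡ leaf) Fs → Z 0 Fs ≡ 1ℚ
  Z-leaves Fs leaves = ∑Concat-leaves 0 Fs (packedWeight 0) leaves

  Z-suc-leaves : ∀ P Fs → All (_≡ leaf) Fs → Z (suc P) Fs ≡ 0ℚ
  Z-suc-leaves P Fs leaves = trans (∑Concat-leaves (suc P) Fs (packedWeight (suc P)) leaves)
    ([no]· (all? (_∈? []) (oneTo (suc P))) (λ { (() ∷ _) }) (factors (suc P) []))

  Z≤ : ℕ → List PTree → ℚ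
  Z≤ zero Fs = Z 0 Fs
  Z≤ (suc n) Fs = Z≤ n Fs + Z (suc n) Fs

  Z≤-leaves : ∀ n Fs → All (_≡ leaf) Fs → Z≤ n Fs ≡ 1ℚ
  Z≤-leaves zero Fs leaves = Z-leaves Fs leaves
  Z≤-leaves (suc n) Fs leaves =
    trans (cong₂ _+_ (Z≤-leaves n Fs leaves) (Z-suc-leaves n Fs leaves)) (ℚ.+-identityʳ 1ℚ)

  Z≤-suc : ∀ n Fs → denom (regionsL Fs) ≢ 0ℚ →
    Z≤ (suc n) Fs ≡ Z 0 Fs + ∑ (λ (F , i) → coef (regionsL Fs) i * Z≤ n F) (expansions Fs)
  Z≤-suc zero Fs D≢0 = cong (Z 0 Fs +_) (Z-suc 0 Fs D≢0)
  Z≤-suc (suc n) Fs D≢0 = begin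
    Z≤ (suc n) Fs + Z (suc (suc n)) Fs
      ≡⟨ cong₂ _+_ (Z≤-suc n Fs D≢0) (Z-suc (suc n) Fs D≢0) ⟩
    (Z 0 Fs + ∑ (coefs (Z≤ n)) (expansions Fs)) + ∑ (coefs (Z (suc n))) (expansions Fs)
      ≡⟨ ℚ.+-assoc (Z 0 Fs) _ _ ⟩
    Z 0 Fs + (∑ (coefs (Z≤ n)) (expansions Fs) + ∑ (coefs (Z (suc n))) (expansions Fs))
      ≡⟨ cong (Z 0 Fs +_) (∑-+ (coefs (Z≤ n)) (coefs (Z (suc n))) (expansions Fs)) ⟨
    Z 0 Fs + ∑ (λ p → coefs (Z≤ n) p + coefs (Z (suc n)) p) (expansions Fs)
      ≡⟨ cong (Z 0 Fs +_) (∑-cong (λ (F , i) → sym (ℚ.*-distribˡ-+ (coef N i) (Z≤ n F) (Z (suc n) F)))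
                                  (expansions Fs)) ⟩
    Z 0 Fs + ∑ (λ (F , i) → coef N i * Z≤ (suc n) F) (expansions Fs) ∎
    where
    open ≡-Reasoning
    N = regionsL Fs
    coefs : (List PTree → ℚ) → List PTree × ℕ → ℚ
    coefs f (F , i) = coef N i * f F

  nodeProdL-leaves : ∀ Fs → All (_≡ leaf) Fs → nodeProdL q t Fs ≡ 1ℚ
  nodeProdL-leaves [] [] = refl
  nodeProdL-leaves (.leaf ∷ Fs) (refl ∷ leaves) = trans (ℚ.*-identityˡ _) (nodeProdL-leaves Fs leaves)

  Z≤-nodeProd : ∀ n Fs → regionsL Fs ≤ n → DenomsNonZero (regionsL Fs) → Z≤ n Fs ≡ nodeProdL q t Fs
  Z≤-nodeProd n Fs r≤n D≢0 with regionsL Fs ℕ.≟ 0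
  ... | yes r≡0 = trans (Z≤-leaves n Fs leaves) (sym (nodeProdL-leaves Fs leaves))
    where leaves = regionsL≡0⇒leaves Fs r≡0
  Z≤-nodeProd zero Fs r≤0 D≢0 | no r≢0 = ⊥-elim (r≢0 (ℕₚ.n≤0⇒n≡0 r≤0))
  Z≤-nodeProd (suc n) Fs r≤1+n D≢0 | no r≢0 = begin
    Z≤ (suc n) Fs
      ≡⟨ Z≤-suc n Fs (D≢0 N (ℕₚ.n≢0⇒n>0 r≢0) ℕₚ.≤-refl) ⟩
    Z 0 Fs + ∑ (λ (F , i) → coef N i * Z≤ n F) (expansions Fs)
      ≡⟨ cong₂ _+_ (∑Concat-empty-alphabet Fs (packedWeight 0) r≢0)
                   (∑-cong-local term (expansions-regions Fs)) ⟩
    0ℚ + ∑ (λ (F , i) → coef N i * nodeProdL q t F) (expansions Fs)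
      ≡⟨ trans (ℚ.+-identityˡ _) (∑-coef-nodeProd Fs D≢0) ⟩
    nodeProdL q t Fs ∎
    where
    open ≡-Reasoning
    N = regionsL Fs
    term : ∀ ((F , i) : List PTree × ℕ) → regionsL F ℕ.+ i ≡ N →
      coef N i * Z≤ n F ≡ coef N i * nodeProdL q t F
    term (F , zero) _ = begin
      coef N 0 * Z≤ n F           ≡⟨ cong (_* Z≤ n F) coef₀≡0 ⟩
      0ℚ * Z≤ n F                 ≡⟨ ℚ.*-zeroˡ (Z≤ n F) ⟩
      0ℚ                          ≡⟨ ℚ.*-zeroˡ (nodeProdL q t F) ⟨
      0ℚ * nodeProdL q t F        ≡⟨ cong (_* nodeProdL q t F) coef₀≡0 ⟨
      coef N 0 * nodeProdL q t F  ∎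
      where coef₀≡0 = coef-zero N (D≢0 N (ℕₚ.n≢0⇒n>0 r≢0) ℕₚ.≤-refl)
    term (F , suc i) F+1+i≡N = cong (coef N (suc i) *_)
      (Z≤-nodeProd n F (ℕₚ.≤-pred (ℕₚ.≤-trans F<N r≤1+n))
                       (DenomsNonZero-mono (ℕₚ.<⇒≤ F<N) D≢0))
      where
      F<N : regionsL F < N
      F<N = ℕₚ.≤-trans (s≤s (ℕₚ.m≤m+n (regionsL F) i))
                       (ℕₚ.≤-reflexive (trans (sym (ℕₚ.+-suc _ i)) F+1+i≡N))

  packedMword-suc : ∀ P u → WordOver (suc P) u →
    [ isPacked (suc P) u ]· Mword q t (suc P) u ≡
    denom (length u) ⁻¹ * weight P 1ℚ (packedWeight P) u + (- denom (length u) ⁻¹) * weight P t (packedWeight P) u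
  packedMword-suc P u u∈P = by-count (countL (suc P) u) refl
    where
    open ℚ-Solver
    i = denom (length u) ⁻¹
    K′ = packedWeight P (erase (suc P) u)
    by-count : ∀ c → countL (suc P) u ≡ c →
      [ isPacked (suc P) u ]· Mword q t (suc P) u ≡
      i * (1ℚ ^ countL (suc P) u * K′) + (- i) * (t ^ countL (suc P) u * K′)
    by-count zero count≡0 rewrite isPacked-suc-absent P u count≡0 | count≡0 =
      solve 2 (λ i k → con 0ℚ := i :* (con 1ℚ :* k) :+ (:- i) :* (con 1ℚ :* k)) refl i K′
    by-count (suc c) count≡1+c
      rewrite isPacked-suc-present P u c count≡1+c | count≡1+c | ^-zeroˡ (suc c)
            | ÷₀≡*⁻¹ (1ℚ - t ^ suc c) (denom (length u)) | sym (factors-erase P u) =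
      trans ([]·-*-comm (isPacked P (erase (suc P) u)) ((1ℚ - t ^ suc c) * i) (factors P (erase (suc P) u)))
            (solve 3 (λ i k τ → (con 1ℚ :- τ) :* i :* k := i :* (con 1ℚ :* k) :+ (:- i) :* (τ :* k))
                     refl i K′ (t ^ suc c))

  MT-part : PTree → ℕ → ℚ
  MT-part T p =
    ∑Words p (regions T) (λ u → [ does (all? (_∈? u) (oneTo p) ×-dec (𝒯 u ≟ᵀ T)) ]· Mword q t p u)

  MT≡∑MT-part : ∀ T → MT q t T ≡ ∑ (MT-part T) (oneTo (regions T))
  MT≡∑MT-part T = begin
    sumL ws                ≡⟨ cong sumL (List.map-id ws) ⟨
    sumL (map id ws)       ≡⟨ sumL-map≡∑ id ws ⟩
    ∑ id ws                ≡⟨ ∑-concatMap id words (oneTo n) ⟩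
    ∑ (λ p → ∑ id (words p)) (oneTo n)
      ≡⟨ ∑-cong (λ p → trans (∑-map id (Mword q t p) _) (∑-filter _ (Mword q t p) (wordsOver p n)))
                (oneTo n) ⟩
    ∑ (MT-part T) (oneTo n) ∎
    where
    open ≡-Reasoning
    n = regions T
    words : ℕ → List ℚ
    words p = map (Mword q t p) (packedWithTree T n p)
    ws = concatMap words (oneTo n)

  MT-part-suc : ∀ P T₀ T₁ Ts →
    MT-part (node T₀ T₁ Ts) (suc P) ≡
    ((1ℚ - t ^ suc (length Ts)) ÷₀ denom (regions (node T₀ T₁ Ts))) * Z P (T₀ ∷ T₁ ∷ Ts)
  MT-part-suc P T₀ T₁ Ts = begin
    MT-part T (suc P)
      ≡⟨ ∑Words-cong-on (suc P) n per-word ⟩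
    ∑Tree (suc P) T (λ u → i * W 1ℚ u + (- i) * W t u)
      ≡⟨ ∑Tree-+ (suc P) T (λ u → i * W 1ℚ u) (λ u → (- i) * W t u) ⟩
    ∑Tree (suc P) T (λ u → i * W 1ℚ u) + ∑Tree (suc P) T (λ u → (- i) * W t u)
      ≡⟨ cong₂ _+_ (∑Tree-*ˡ (suc P) T i (W 1ℚ)) (∑Tree-*ˡ (suc P) T (- i) (W t)) ⟩
    i * ∑Tree (suc P) T (W 1ℚ) + (- i) * ∑Tree (suc P) T (W t)
      ≡⟨ cong₂ (λ a b → i * a + (- i) * b) (∑Tree-suc-node-weight P 1ℚ T₀ T₁ Ts K)
                                            (∑Tree-suc-node-weight P t T₀ T₁ Ts K) ⟩
    i * (1ℚ * R + 1ℚ ^ k * Y) + (- i) * (1ℚ * R + t ^ k * Y)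
      ≡⟨ cong (λ o → i * (1ℚ * R + o * Y) + (- i) * (1ℚ * R + t ^ k * Y)) (^-zeroˡ k) ⟩
    i * (1ℚ * R + 1ℚ * Y) + (- i) * (1ℚ * R + t ^ k * Y)
      ≡⟨ solve 4 (λ i R Y τ → i :* (con 1ℚ :* R :+ con 1ℚ :* Y) :+ (:- i) :* (con 1ℚ :* R :+ τ :* Y)
                              := (con 1ℚ :- τ) :* i :* Y)
               refl i R Y (t ^ k) ⟩
    (1ℚ - t ^ k) * i * Y
      ≡⟨ cong (_* Y) (÷₀≡*⁻¹ (1ℚ - t ^ k) (denom n)) ⟨
    ((1ℚ - t ^ k) ÷₀ denom n) * Y ∎
    where
    open ≡-Reasoning
    open ℚ-Solver
    T = node T₀ T₁ Ts
    n = regions T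
    k = suc (length Ts)
    i = denom n ⁻¹
    K = packedWeight P
    W : ℚ → Word → ℚ
    W x = weight P x K
    R = ∑Concat P [ T ] K
    Y = Z P (T₀ ∷ T₁ ∷ Ts)
    per-word : ∀ u → WordOver (suc P) u → length u ≡ n →
      [ isPacked (suc P) u ∧ does (𝒯 u ≟ᵀ T) ]· Mword q t (suc P) u ≡
      [ hasTree (suc P) T u ]· (i * W 1ℚ u + (- i) * W t u)
    per-word u u∈P |u|≡n = begin
      [ isPacked (suc P) u ∧ does (𝒯 u ≟ᵀ T) ]· Mword q t (suc P) u
        ≡⟨ cong ([_]· Mword q t (suc P) u) (∧-comm (isPacked (suc P) u) _) ⟩
      [ does (𝒯 u ≟ᵀ T) ∧ isPacked (suc P) u ]· Mword q t (suc P) u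
        ≡⟨ []·-∧ (does (𝒯 u ≟ᵀ T)) (isPacked (suc P) u) _ ⟨
      [ does (𝒯 u ≟ᵀ T) ]· [ isPacked (suc P) u ]· Mword q t (suc P) u
        ≡⟨ cong₂ (λ U z → [ does (U ≟ᵀ T) ]· z) (sym (build-above-maxL (suc P) u (maxL≤ (suc P) u u∈P)))
                                                (packedMword-suc P u u∈P) ⟩
      [ hasTree (suc P) T u ]· (denom (length u) ⁻¹ * W 1ℚ u + (- denom (length u) ⁻¹) * W t u)
        ≡⟨ cong (λ m → [ hasTree (suc P) T u ]· (denom m ⁻¹ * W 1ℚ u + (- denom m ⁻¹) * W t u)) |u|≡n ⟩
      [ hasTree (suc P) T u ]· (i * W 1ℚ u + (- i) * W t u) ∎

  ∑-MT-part : ∀ T₀ T₁ Ts m →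
    ∑ (MT-part (node T₀ T₁ Ts)) (oneTo (suc m)) ≡
    ((1ℚ - t ^ suc (length Ts)) ÷₀ denom (regions (node T₀ T₁ Ts))) * Z≤ m (T₀ ∷ T₁ ∷ Ts)
  ∑-MT-part T₀ T₁ Ts zero = trans (∑-[ MT-part (node T₀ T₁ Ts) ] 1) (MT-part-suc 0 T₀ T₁ Ts)
  ∑-MT-part T₀ T₁ Ts (suc m) = begin
    ∑ (MT-part T) (oneTo (suc (suc m)))
      ≡⟨ ∑-oneTo-suc (suc m) (MT-part T) ⟩
    ∑ (MT-part T) (oneTo (suc m)) + MT-part T (suc (suc m))
      ≡⟨ cong₂ _+_ (∑-MT-part T₀ T₁ Ts m) (MT-part-suc (suc m) T₀ T₁ Ts) ⟩
    c * Z≤ m (T₀ ∷ T₁ ∷ Ts) + c * Z (suc m) (T₀ ∷ T₁ ∷ Ts)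
      ≡⟨ ℚ.*-distribˡ-+ c _ _ ⟨
    c * Z≤ (suc m) (T₀ ∷ T₁ ∷ Ts) ∎
    where
    open ≡-Reasoning
    T = node T₀ T₁ Ts
    c = (1ℚ - t ^ suc (length Ts)) ÷₀ denom (regions T)

theorem8p1 : (l r : PTree) (ts : List PTree) (q t : ℚ) →
    (∀ (k : ℕ) → 1 ≤ k → k ≤ regions (node l r ts) → q ^ k ≢ 1ℚ) →
    MT q t (node l r ts) ≡ rhs q t l r ts
theorem8p1 l r ts q t q^k≢1 = begin
  MT q t (node l r ts)                       ≡⟨ MT≡∑MT-part (node l r ts) ⟩
  ∑ (MT-part (node l r ts)) (oneTo (suc n))  ≡⟨ ∑-MT-part l r ts n ⟩
  c * Z≤ n (children l r ts)                 ≡⟨ cong (c *_) (Z≤-nodeProd n (children l r ts) children≤n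
                                                              (DenomsNonZero-mono children≤n denoms)) ⟩
  c * nodeProdL q t (children l r ts)        ∎
  where
  open ≡-Reasoning
  open Specialisation q t
  n = length ts ℕ.+ regionsL (children l r ts)
  c = (1ℚ - t ^ suc (length ts)) ÷₀ denom (suc n)
  children≤n : regionsL (children l r ts) ≤ n
  children≤n = ℕₚ.m≤n+m _ (length ts)
  denoms : DenomsNonZero n
  denoms k 1≤k k≤n 1-q^k≡0 = q^k≢1 k 1≤k (ℕₚ.m≤n⇒m≤1+n k≤n) (1-x≡0⇒x≡1 (q ^ k) 1-q^k≡0)
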